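{- Let $D \geq 2$ be a squarefree integer, let $K = \mathbb{Q}(\sqrt{D})$ with ring of integers $\mathcal{O}_K$ and discriminant $\Delta$, and let $m \geq 1$ be an integer. If $\alpha \in \mathcal{O}_K^+$ can be represented as a sum of indecomposables in at most $m$ ways, i.e. $p_K(\alpha\,|\,\mathcal{I}) \leq m$, then \[ \mathrm{N}(\alpha) < m^2(2m+1)(2m+3)\cdot \sqrt{\Delta}\left(\sqrt{\Delta}+2\right)^2 . \]
   Context: $\mathcal{O}_K^+$ denotes the set of totally positive elements of $\mathcal{O}_K$ (elements $\alpha$ with $\alpha>0$ and $\alpha'>0$, where $\alpha'$ is the Galois conjugate). $\mathrm{N}(\alpha)=\alpha\alpha'$ is the norm. The discriminant is $\Delta = D$ if $D \equiv 1 \pmod 4$ and $\Delta = 4D$ if $D \equiv 2,3 \pmod 4$. An element $\alpha \in \mathcal{O}_K^+$ is indecomposable if there are no $\beta,\gamma \in \mathcal{O}_K^+$ with $\alpha=\beta+\gamma$. For $\alpha\in\mathcal{O}_K^+$, $p_K(\alpha\,|\,\mathcal{I})$ is the number of ways to write $\alpha = \lambda_1+\dots+\lambda_\ell$ ($\ell\ge 1$) with all $\lambda_i$ indecomposable, where representations differing only in the order of the summands are counted as the same. -}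

module Defs where

open import Data.Nat as ℕ using (ℕ; zero; suc; _∸_)
open import Data.Nat.DivMod using (_%_; _/_)
open import Data.Nat.Divisibility using (_∣_)
open import Data.Integer as ℤ using (ℤ; +_; _+_; _*_; _-_; _<_)
open import Data.Bool using (Bool; if_then_else_)
open import Data.Fin using (Fin)
open import Data.Product using (_×_; _,_; ∃₂)
open import Data.Sum using (_⊎_)
open import Data.List using (List; []; foldr)
open import Data.List.Relation.Unary.All using (All)
open import Data.List.Relation.Binary.Permutation.Propositional using (_↭_)
open import Relation.Nullary using (does; ¬_)
open import Relation.Binary.PropositionalEquality using (_≡_; _≢_)

SquareFree : ℕ → Set
SquareFree D = ∀ n → n ℕ.* n ∣ D → n ≡ 1

oneMod4 : ℕ → Bool
oneMod4 D = does (D % 4 ℕ.≟ 1)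

disc : ℕ → ℕ
disc D = if oneMod4 D then D else 4 ℕ.* D

-- An element of O_K, K = Q(√D), is a pair (a , b) standing for a + b ω,
-- where ω = (1 + √D)/2 if D ≡ 1 (mod 4) and ω = √D otherwise
-- (the standard integral basis {1, ω}; the representation is unique).
OK : Set
OK = ℤ × ℤ

addOK : OK → OK → OK
addOK (a , b) (c , d) = (a + c , b + d)

zeroOK : OK
zeroOK = (+ 0 , + 0)

sumOK : List OK → ℤ × ℤ
sumOK = foldr addOK zeroOK

-- Writing 2α = X + Y √D with X, Y ∈ ℤ:
twiceX : ℕ → OK → ℤ
twiceX D (a , b) = if oneMod4 D then + 2 * a + b else + 2 * a

twiceY : ℕ → OK → ℤ
twiceY D (a , b) = if oneMod4 D then b else + 2 * b

-- α totally positive: α > 0 and α' > 0, i.e. X > |Y| √D, i.e. X > 0 and D Y² < X².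
TotPos : ℕ → OK → Set
TotPos D α = (+ 0 < twiceX D α) × (+ D * twiceY D α * twiceY D α < twiceX D α * twiceX D α)

norm : ℕ → OK → ℤ
norm D (a , b) =
  if oneMod4 D
  then a * a + a * b - b * b * + ((D ∸ 1) / 4)
  else a * a - + D * b * b

Indecomposable : ℕ → OK → Set
Indecomposable D α =
  TotPos D α × ¬ (∃₂ λ β γ → TotPos D β × TotPos D γ × α ≡ addOK β γ)

IsRep : ℕ → OK → List OK → Set
IsRep D α l = (l ≢ []) × All (Indecomposable D) l × (sumOK l ≡ α)

-- p_K(α | I) ≤ m: among any m+1 representations, two (at distinct positions)
-- coincide up to the order of summands.
AtMostRepsCount : ℕ → OK → ℕ → Set
AtMostRepsCount D α m =
  (r : Fin (suc m) → List OK) → (∀ i → IsRep D α (r i)) →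
  ∃₂ λ i j → (i ≢ j) × (r i ↭ r j)

-- x < y · √d  for integers x, y with y ≥ 0 and d ≥ 0 (exact, no reals):
-- holds iff x < 0 or x² < y² d.
_<_·√_ : ℤ → ℤ → ℤ → Set
x < y ·√ d = (x < + 0) ⊎ (x * x < y * y * d)

-- Write α = s λ + t μ in a basis of totally positive λ, μ with det(λ, μ) = 1 and N(μ - λ) < 0
-- (found by a descent on lattice cones containing α); such λ, μ are indecomposable. Let
-- T = Tr(λ μ'), so T² - 4 N(λ) N(μ) = Δ, and let c ≈ (T + √Δ) / (2 N(λ)) be least with c λ - μ
-- totally positive. If s ≥ m c, splitting j of m blocks c λ as μ + (c λ - μ), j = 0, …, m, gives
-- m + 1 distinct representations of α. Hence s < m c and symmetrically t < m c', and expanding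
-- N(α) = s² N(λ) + s t T + t² N(μ) gives the bound.

module Submission where

open import Data.Nat as ℕ using (ℕ)
open import Defs using (SquareFree)

module IntegerInequalities where

  open import Data.Nat as ℕ using (ℕ; zero; suc)
  open import Data.Nat.DivMod using (_/_; m/n*n≤m; m%n<n; m≡m%n+[m/n]*n)
  import Data.Nat.Properties as ℕP
  open import Data.Integer
    using (ℤ; +_; -[1+_]; 0ℤ; _+_; _*_; _-_; -_; _<_; _≤_; ∣_∣; +≤+; +<+; nonNegative; positive)
  import Data.Integer.Properties as ℤP
  open import Data.Integer.Tactic.RingSolver using (solve-∀)
  open import Data.Empty using (⊥; ⊥-elim)
  open import Data.Sum using (_⊎_; inj₁; inj₂)
  open import Data.Product using (Σ; _×_; _,_)
  open import Relation.Binary using (tri<; tri≈; tri>)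
  open import Relation.Binary.PropositionalEquality
  open import Relation.Nullary using (yes; no)

  private variable i j k l : ℤ

  0≤+ : 0ℤ ≤ i → 0ℤ ≤ j → 0ℤ ≤ i + j
  0≤+ = ℤP.+-mono-≤

  0<+ : 0ℤ < i → 0ℤ ≤ j → 0ℤ < i + j
  0<+ = ℤP.+-mono-<-≤

  0≤* : 0ℤ ≤ i → 0ℤ ≤ j → 0ℤ ≤ i * j
  0≤* {j = j} 0≤i 0≤j = ℤP.*-monoʳ-≤-nonNeg j {{nonNegative 0≤j}} 0≤i

  0<* : 0ℤ < i → 0ℤ < j → 0ℤ < i * j
  0<* {j = j} 0<i 0<j = ℤP.*-monoʳ-<-pos j {{positive 0<j}} 0<i

  0≤n : ∀ n → 0ℤ ≤ + n
  0≤n n = +≤+ ℕ.z≤n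

  0<1+n : ∀ n → 0ℤ < + suc n
  0<1+n n = +<+ (ℕ.s≤s ℕ.z≤n)

  0≤i*i : ∀ i → 0ℤ ≤ i * i
  0≤i*i (+ n) rewrite sym (ℤP.pos-* n n) = 0≤n (n ℕ.* n)
  0≤i*i -[1+ n ] = 0≤n _

  0<i*i : i ≢ 0ℤ → 0ℤ < i * i
  0<i*i {+ zero} i≢0 = ⊥-elim (i≢0 refl)
  0<i*i {+ suc n} _ = 0<* (0<1+n n) (0<1+n n)
  0<i*i { -[1+ n ]} _ = 0<1+n _

  <⇒0<- : i < j → 0ℤ < j - i
  <⇒0<- {i} {j} i<j = subst (_< j - i) (ℤP.+-inverseʳ i) (ℤP.+-monoˡ-< (- i) i<j)

  0<-⇒< : 0ℤ < j - i → i < j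
  0<-⇒< {j} {i} 0<j-i = subst₂ _<_ (ℤP.+-identityˡ i) (cancel j i) (ℤP.+-monoˡ-< i 0<j-i)
    where
    cancel : ∀ j i → j - i + i ≡ j
    cancel = solve-∀

  ≤-by-difference : ∀ k → j - i ≡ k → 0ℤ ≤ k → i ≤ j
  ≤-by-difference k j-i≡k 0≤k = ℤP.0≤i-j⇒j≤i (subst (0ℤ ≤_) (sym j-i≡k) 0≤k)

  <-by-difference : ∀ k → j - i ≡ k → 0ℤ < k → i < j
  <-by-difference k j-i≡k 0<k = 0<-⇒< (subst (0ℤ <_) (sym j-i≡k) 0<k)

  0<-i⇒i<0 : 0ℤ < - i → i < 0ℤ
  0<-i⇒i<0 = ℤP.neg-cancel-<

  i<0⇒0<-i : i < 0ℤ → 0ℤ < - i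
  i<0⇒0<-i = ℤP.neg-mono-<

  sign-trichotomy : ∀ i → 0ℤ < i ⊎ i ≡ 0ℤ ⊎ 0ℤ < - i
  sign-trichotomy i with ℤP.<-cmp 0ℤ i
  ... | tri< 0<i _ _ = inj₁ 0<i
  ... | tri≈ _ 0≡i _ = inj₂ (inj₁ (sym 0≡i))
  ... | tri> _ _ i<0 = inj₂ (inj₂ (i<0⇒0<-i i<0))

  0≤i⇒¬0<-i : 0ℤ ≤ i → 0ℤ < - i → ⊥
  0≤i⇒¬0<-i 0≤i 0<-i = ℤP.<⇒≱ (0<-i⇒i<0 0<-i) 0≤i

  0<*⇒0< : 0ℤ < k → 0ℤ < k * i → 0ℤ < i
  0<*⇒0< {k} {i} 0<k 0<ki with sign-trichotomy i
  ... | inj₁ 0<i = 0<i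
  ... | inj₂ (inj₁ refl) = ⊥-elim (ℤP.<-irrefl (sym (ℤP.*-zeroʳ k)) 0<ki)
  ... | inj₂ (inj₂ 0<-i) = ⊥-elim (0≤i⇒¬0<-i (ℤP.<⇒≤ 0<ki) (subst (0ℤ <_) (sym (ℤP.neg-distribʳ-* k i)) (0<* 0<k 0<-i)))

  0≤*⇒0≤ : 0ℤ < k → 0ℤ ≤ k * i → 0ℤ ≤ i
  0≤*⇒0≤ {k} {i} 0<k 0≤ki with sign-trichotomy i
  ... | inj₁ 0<i = ℤP.<⇒≤ 0<i
  ... | inj₂ (inj₁ refl) = ℤP.≤-refl
  ... | inj₂ (inj₂ 0<-i) = ⊥-elim (0≤i⇒¬0<-i 0≤ki (subst (0ℤ <_) (sym (ℤP.neg-distribʳ-* k i)) (0<* 0<k 0<-i)))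

  *-mono-≤-nonNeg : 0ℤ ≤ j → 0ℤ ≤ k → i ≤ j → k ≤ l → i * k ≤ j * l
  *-mono-≤-nonNeg {j} {k} {i} {l} 0≤j 0≤k i≤j k≤l =
    ℤP.≤-trans (ℤP.*-monoʳ-≤-nonNeg k {{nonNegative 0≤k}} i≤j) (ℤP.*-monoˡ-≤-nonNeg j {{nonNegative 0≤j}} k≤l)

  *-monoʳ-<-pos : 0ℤ < k → i < j → i * k < j * k
  *-monoʳ-<-pos {k} {i} {j} 0<k i<j = 0<-⇒< (subst (0ℤ <_) (sym (distrib j i k)) (0<* (<⇒0<- i<j) 0<k))
    where
    distrib : ∀ j i k → j * k - i * k ≡ (j - i) * k
    distrib = solve-∀

  *-cancelˡ-≤-pos : 0ℤ < k → k * i ≤ k * j → i ≤ j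
  *-cancelˡ-≤-pos {k} {i} {j} 0<k ki≤kj with ℤP.<-cmp i j
  ... | tri< i<j _ _ = ℤP.<⇒≤ i<j
  ... | tri≈ _ refl _ = ℤP.≤-refl
  ... | tri> _ _ j<i = ⊥-elim (ℤP.<⇒≱ (subst₂ _<_ (ℤP.*-comm j k) (ℤP.*-comm i k) (*-monoʳ-<-pos 0<k j<i)) ki≤kj)

  i*i<j*j : 0ℤ ≤ i → i < j → i * i < j * j
  i*i<j*j {i} {j} 0≤i i<j =
    0<-⇒< (subst (0ℤ <_) (sym (difference-of-squares j i)) (0<* (<⇒0<- i<j) (0<+ (ℤP.≤-<-trans 0≤i i<j) 0≤i)))
    where
    difference-of-squares : ∀ j i → j * j - i * i ≡ (j - i) * (j + i)
    difference-of-squares = solve-∀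

  i*i<j*j⇒i<j : 0ℤ < j → i * i < j * j → i < j
  i*i<j*j⇒i<j {j} {i} 0<j i²<j² with ℤP.<-cmp i j
  ... | tri< i<j _ _ = i<j
  ... | tri≈ _ refl _ = ⊥-elim (ℤP.<-irrefl refl i²<j²)
  ... | tri> _ _ j<i = ⊥-elim (ℤP.<-asym i²<j² (i*i<j*j (ℤP.<⇒≤ 0<j) j<i))

  i*i≤j*j⇒i≤j : 0ℤ ≤ j → i * i ≤ j * j → i ≤ j
  i*i≤j*j⇒i≤j {j} {i} 0≤j i²≤j² with ℤP.<-cmp i j
  ... | tri< i<j _ _ = ℤP.<⇒≤ i<j
  ... | tri≈ _ refl _ = ℤP.≤-refl
  ... | tri> _ _ j<i = ⊥-elim (ℤP.<⇒≱ (i*i<j*j 0≤j j<i) i²≤j²)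

  i*i≡0⇒i≡0 : i * i ≡ 0ℤ → i ≡ 0ℤ
  i*i≡0⇒i≡0 {i} i²≡0 with i ℤP.≟ 0ℤ
  ... | yes i≡0 = i≡0
  ... | no i≢0 = ⊥-elim (ℤP.<-irrefl (sym i²≡0) (0<i*i i≢0))

  private
    floor-sqrtℕ : (n : ℕ) → Σ ℕ λ g → g ℕ.* g ℕ.≤ n × n ℕ.< suc g ℕ.* suc g
    floor-sqrtℕ zero = 0 , ℕ.z≤n , ℕ.s≤s ℕ.z≤n
    floor-sqrtℕ (suc n) with floor-sqrtℕ n
    ... | g , g²≤n , n<[1+g]² with suc g ℕ.* suc g ℕP.≤? suc n
    ...   | yes [1+g]²≤1+n = suc g , [1+g]²≤1+n , ℕP.≤-<-trans n<[1+g]² (ℕP.*-mono-< (ℕP.n<1+n (suc g)) (ℕP.n<1+n (suc g)))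
    ...   | no [1+g]²≰1+n = g , ℕP.m≤n⇒m≤1+n g²≤n , ℕP.≰⇒> [1+g]²≰1+n

  ∣i∣<∣j∣ : 0ℤ ≤ i → i < j → ∣ i ∣ ℕ.< ∣ j ∣
  ∣i∣<∣j∣ (+≤+ _) (+<+ m<n) = m<n

  ∣i+j∣≢1 : 0ℤ < i → 0ℤ < j → ∣ i + j ∣ ≢ 1
  ∣i+j∣≢1 {+ suc m} {+ suc n} (+<+ _) (+<+ _) ∣i+j∣≡1 with ℕP.m+n≡0⇒n≡0 m (cong ℕ.pred ∣i+j∣≡1)
  ... | ()

  0<i⇒i≡1+n : 0ℤ < i → Σ ℕ λ n → i ≡ + suc n
  0<i⇒i≡1+n {+ suc n} _ = n , refl
  0<i⇒i≡1+n {+ zero} (+<+ ())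

  floor-quotient : ∀ {d n} → 0ℤ < d → 0ℤ ≤ n → Σ ℕ λ q → d * + q ≤ n × n < d * + suc q
  floor-quotient {+ suc d-1} {+ n} _ (+≤+ _) =
    n / d , subst (_≤ + n) (pos-*-comm (n / d)) (+≤+ (m/n*n≤m n d)) , subst (+ n <_) (pos-*-comm (suc (n / d))) (+<+ n<[1+q]*d)
    where
    d = suc d-1
    pos-*-comm : ∀ q → + (q ℕ.* d) ≡ + d * + q
    pos-*-comm q = trans (ℤP.pos-* q d) (ℤP.*-comm (+ q) (+ d))
    n<[1+q]*d : n ℕ.< suc (n / d) ℕ.* d
    n<[1+q]*d = subst (ℕ._< d ℕ.+ (n / d) ℕ.* d) (sym (m≡m%n+[m/n]*n n d)) (ℕP.+-monoˡ-< ((n / d) ℕ.* d) (m%n<n n d))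
  floor-quotient {+ zero} (+<+ ())

  floor-sqrt : ∀ n → Σ ℕ λ g → + g * + g ≤ + n × + n < (+ g + + 1) * (+ g + + 1)
  floor-sqrt n with floor-sqrtℕ n
  ... | g , g²≤n , n<[1+g]² = g , subst (_≤ + n) (ℤP.pos-* g g) (+≤+ g²≤n) , subst (+ n <_) [1+g]²≡ (+<+ n<[1+g]²)
    where
    [1+g]²≡ : + (suc g ℕ.* suc g) ≡ (+ g + + 1) * (+ g + + 1)
    [1+g]²≡ = trans (ℤP.pos-* (suc g) (suc g)) (cong (λ x → x * x) (trans (cong +_ (ℕP.+-comm 1 g)) (ℤP.pos-+ g 1)))

module NonSquare where

  open import Defs using (SquareFree)
  open import Data.Nat using (_*_; _≤_; NonZero; ≢-nonZero)
  import Data.Nat.Properties as ℕP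
  open import Data.Nat.DivMod using (_/_; m/n*n≡m)
  open import Data.Nat.GCD using (gcd; gcd[m,n]∣m; gcd[m,n]∣n; gcd[m,n]≢0)
  open import Data.Nat.Coprimality using (Coprime; coprime-/gcd; coprime-divisor)
  import Data.Nat.Coprimality as Coprimality
  open import Data.Nat.Divisibility using (_∣_; divides; ∣-refl)
  open import Data.Nat.Tactic.RingSolver using (solve-∀)
  open import Data.Sum using (inj₂)
  open import Data.Product using (_,_)
  open import Relation.Binary.PropositionalEquality

  -- Cancelling g = gcd x y reduces to coprime x', y' with D y'² = x'²; then y' ∣ x'² forces y' = 1,
  -- so D = x'² and squarefreeness gives D = 1.
  squareFree⇒D*y²≢x² : ∀ D → 2 ≤ D → SquareFree D → ∀ x y → 1 ≤ y → D * (y * y) ≢ x * x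
  squareFree⇒D*y²≢x² D 2≤D sf x y 1≤y Dy²≡x² = ℕP.<⇒≢ 2≤D (sym D≡1)
    where
    g = gcd x y
    instance
      g≢0 : NonZero g
      g≢0 = ≢-nonZero (gcd[m,n]≢0 x y (inj₂ λ y≡0 → ℕP.<⇒≢ 1≤y (sym y≡0)))
    x' = x / g
    y' = y / g
    x≡x'g : x ≡ x' * g
    x≡x'g = sym (m/n*n≡m (gcd[m,n]∣m x y))
    y≡y'g : y ≡ y' * g
    y≡y'g = sym (m/n*n≡m (gcd[m,n]∣n x y))
    coprime : Coprime x' y'
    coprime = coprime-/gcd x y
    scale : ∀ d u g → d * ((u * g) * (u * g)) ≡ (d * (u * u)) * (g * g)
    scale = solve-∀
    square-scale : ∀ u g → (u * g) * (u * g) ≡ (u * u) * (g * g)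
    square-scale = solve-∀
    reduced : D * (y' * y') ≡ x' * x'
    reduced = ℕP.*-cancelʳ-≡ _ _ (g * g) {{ℕP.m*n≢0 g g}} (begin
      (D * (y' * y')) * (g * g) ≡⟨ sym (scale D y' g) ⟩
      D * ((y' * g) * (y' * g))  ≡⟨ cong (λ z → D * (z * z)) (sym y≡y'g) ⟩
      D * (y * y)                ≡⟨ Dy²≡x² ⟩
      x * x                      ≡⟨ cong (λ z → z * z) x≡x'g ⟩
      (x' * g) * (x' * g)        ≡⟨ square-scale x' g ⟩
      (x' * x') * (g * g)        ∎)
      where open ≡-Reasoning
    y'∣x'² : y' ∣ x' * x'
    y'∣x'² = divides (D * y') (trans (sym reduced) (sym (ℕP.*-assoc D y' y')))
    y'≡1 : y' ≡ 1
    y'≡1 = coprime (coprime-divisor (Coprimality.sym coprime) y'∣x'² , ∣-refl)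
    D≡x'² : D ≡ x' * x'
    D≡x'² = trans (sym (trans (cong (λ z → D * (z * z)) y'≡1) (ℕP.*-identityʳ D))) reduced
    x'≡1 : x' ≡ 1
    x'≡1 = sf x' (divides 1 (trans D≡x'² (sym (ℕP.*-identityˡ (x' * x')))))
    D≡1 : D ≡ 1
    D≡1 = trans D≡x'² (cong (λ z → z * z) x'≡1)

module FormBound where

  open import Data.Integer using (ℤ; +_; 0ℤ; _+_; _*_; _-_; -_; _<_; _≤_; nonNegative)
  import Data.Integer.Properties as ℤP
  open import Data.Integer.Tactic.RingSolver using (solve-∀; solve)
  open import Data.List using (_∷_; [])
  open import Relation.Binary.PropositionalEquality
  open IntegerInequalities
  open ℤP.≤-Reasoning

  4a≤T²-4ab : ∀ {a b T} → 0ℤ ≤ a → 0ℤ < T - a - b → + 4 * a ≤ T * T - + 4 * a * b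
  4a≤T²-4ab {a} {b} {T} 0≤a 0<T-a-b = begin
    + 4 * a                                                ≡⟨ solve (a ∷ []) ⟩
    + 4 * a * + 1                                          ≤⟨ *-mono-≤-nonNeg (0≤* (0≤n 4) 0≤a) (0≤n 1) ℤP.≤-refl (ℤP.i<j⇒suc[i]≤j 0<T-a-b) ⟩
    + 4 * a * (T - a - b)                                  ≤⟨ ℤP.i≤i+j _ _ {{nonNegative (0≤i*i (T - + 2 * a))}} ⟩
    + 4 * a * (T - a - b) + (T - + 2 * a) * (T - + 2 * a)  ≡⟨ solve (a ∷ b ∷ T ∷ []) ⟩
    T * T - + 4 * a * b                                    ∎

  -- the binary quadratic form  N(s λ + t μ) = s² N(λ) + s t Tr(λ μ') + t² N(μ)
  form : (a T b s t : ℤ) → ℤ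
  form a T b s t = s * s * a + s * t * T + t * t * b

  module Bounds {a b T Δ g : ℤ}
    (0<a : 0ℤ < a) (0<b : 0ℤ < b) (0<T-a-b : 0ℤ < T - a - b) (T²≡Δ+4ab : T * T ≡ Δ + + 4 * a * b)
    (0≤g : 0ℤ ≤ g) (g²≤Δ : g * g ≤ Δ) (Δ<[g+1]² : Δ < (g + + 1) * (g + + 1)) (5≤Δ : + 5 ≤ Δ) where

    private
      0≤a = ℤP.<⇒≤ 0<a
      0≤b = ℤP.<⇒≤ 0<b
      0≤Δ = ℤP.≤-trans (0≤n 5) 5≤Δ
      0<ab = 0<* 0<a 0<b
      0≤ab = ℤP.<⇒≤ 0<ab

    0<T : 0ℤ < T
    0<T = begin-strict
      0ℤ                   <⟨ 0<+ (0<+ 0<T-a-b 0≤a) 0≤b ⟩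
      T - a - b + a + b    ≡⟨ solve (a ∷ b ∷ T ∷ []) ⟩
      T                    ∎

    a<T : a < T
    a<T = <-by-difference (T - a - b + b) (solve (a ∷ b ∷ T ∷ [])) (0<+ 0<T-a-b 0≤b)

    b<T : b < T
    b<T = <-by-difference (T - a - b + a) (solve (a ∷ b ∷ T ∷ [])) (0<+ 0<T-a-b 0≤a)

    Δ<T² : Δ < T * T
    Δ<T² = 0<-⇒< (subst (0ℤ <_) (begin-equality
      + 4 * (a * b)              ≡⟨ solve (a ∷ b ∷ Δ ∷ []) ⟩
      Δ + + 4 * a * b - Δ        ≡⟨ cong (_- Δ) (sym T²≡Δ+4ab) ⟩
      T * T - Δ                  ∎) (0<* (0<1+n 3) 0<ab))

    g<T : g < T
    g<T = i*i<j*j⇒i<j 0<T (ℤP.≤-<-trans g²≤Δ Δ<T²)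

    4a≤Δ : + 4 * a ≤ Δ
    4a≤Δ = subst (+ 4 * a ≤_) Δ≡T²-4ab (4a≤T²-4ab {a} {b} {T} 0≤a 0<T-a-b)
      where
      Δ≡T²-4ab : T * T - + 4 * a * b ≡ Δ
      Δ≡T²-4ab = trans (cong (_- + 4 * a * b) T²≡Δ+4ab) (solve (a ∷ b ∷ Δ ∷ []))

    4b≤Δ : + 4 * b ≤ Δ
    4b≤Δ = subst (+ 4 * b ≤_) Δ≡T²-4ba (4a≤T²-4ab {b} {a} {T} 0≤b 0<T-b-a)
      where
      Δ≡T²-4ba : T * T - + 4 * b * a ≡ Δ
      Δ≡T²-4ba = trans (cong (_- + 4 * b * a) T²≡Δ+4ab) (solve (a ∷ b ∷ Δ ∷ []))
      0<T-b-a : 0ℤ < T - b - a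
      0<T-b-a = begin-strict
        0ℤ          <⟨ 0<T-a-b ⟩
        T - a - b   ≡⟨ solve (a ∷ b ∷ T ∷ []) ⟩
        T - b - a   ∎

    2≤g : + 2 ≤ g
    2≤g = ℤP.≮⇒≥ λ g<2 → ℤP.<-irrefl refl (begin-strict
      + 4                        <⟨ ℤP.suc[i]≤j⇒i<j 5≤Δ ⟩
      Δ                          <⟨ Δ<[g+1]² ⟩
      (g + + 1) * (g + + 1)      ≤⟨ *-mono-≤-nonNeg (0≤n 2) (0≤+ 0≤g (0≤n 1)) (g+1≤2 g<2) (g+1≤2 g<2) ⟩
      + 4                        ∎)
      where
      g+1≤2 : g < + 2 → g + + 1 ≤ + 2
      g+1≤2 g<2 = subst (_≤ + 2) (ℤP.+-comm (+ 1) g) (ℤP.i<j⇒suc[i]≤j g<2)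

    T≤Δ : T ≤ Δ
    T≤Δ = i*i≤j*j⇒i≤j 0≤Δ (*-cancelˡ-≤-pos (0<1+n 3) (begin
      + 4 * (T * T)              ≡⟨ cong (+ 4 *_) T²≡Δ+4ab ⟩
      + 4 * (Δ + + 4 * a * b)    ≡⟨ solve (a ∷ b ∷ Δ ∷ []) ⟩
      + 4 * Δ + + 4 * a * (+ 4 * b) ≤⟨ ℤP.+-monoʳ-≤ (+ 4 * Δ) (*-mono-≤-nonNeg 0≤Δ (0≤* (0≤n 4) 0≤b) 4a≤Δ 4b≤Δ) ⟩
      + 4 * Δ + Δ * Δ            ≤⟨ ≤-by-difference (Δ * (+ 3 * (Δ - + 5) + + 11)) (solve (Δ ∷ [])) (0≤* 0≤Δ (0≤+ (0≤* (0≤n 3) (ℤP.i≤j⇒0≤j-i 5≤Δ)) (0≤n 11))) ⟩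
      + 4 * (Δ * Δ)              ∎))

    8T≤15abg : + 8 * T ≤ + 15 * (a * b) * g
    8T≤15abg = i*i≤j*j⇒i≤j (0≤* (0≤* (0≤n 15) 0≤ab) 0≤g) (begin
      (+ 8 * T) * (+ 8 * T)                      ≡⟨ solve (T ∷ []) ⟩
      + 64 * (T * T)                             ≡⟨ cong (+ 64 *_) T²≡Δ+4ab ⟩
      + 64 * (Δ + + 4 * a * b)                   ≡⟨ solve (a ∷ b ∷ Δ ∷ []) ⟩
      + 64 * Δ + + 256 * (a * b)                 ≤⟨ ℤP.+-monoˡ-≤ (+ 256 * (a * b)) (ℤP.*-monoˡ-≤-nonNeg (+ 64) Δ≤g²+2g) ⟩
      + 64 * (g * g + + 2 * g) + + 256 * (a * b) ≤⟨ ≤-by-difference _ (expand (a * b) g) slack ⟩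
      (+ 15 * (a * b) * g) * (+ 15 * (a * b) * g) ∎)
      where
      Δ≤g²+2g : Δ ≤ g * g + + 2 * g
      Δ≤g²+2g = begin
        Δ                                ≤⟨ ℤP.i<j⇒i≤pred[j] Δ<[g+1]² ⟩
        - + 1 + (g + + 1) * (g + + 1)    ≡⟨ solve (g ∷ []) ⟩
        g * g + + 2 * g                  ∎
      expand : ∀ u g → (+ 15 * u * g) * (+ 15 * u * g) - (+ 64 * (g * g + + 2 * g) + + 256 * u) ≡
        + 128 * (g * g) * ((u - + 1) * (u + + 1)) + + 64 * g * (g - + 2)
          + u * (+ 97 * (u - + 1) * (g * g) + + 97 * ((g - + 2) * (g + + 2)) + + 132)
      expand = solve-∀
      0≤u-1 = ℤP.i≤j⇒0≤j-i (ℤP.i<j⇒suc[i]≤j 0<ab)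
      0≤g-2 = ℤP.i≤j⇒0≤j-i 2≤g
      slack = 0≤+ (0≤+ (0≤* (0≤* (0≤n 128) (0≤i*i g)) (0≤* 0≤u-1 (0≤+ 0≤ab (0≤n 1))))
                       (0≤* (0≤* (0≤n 64) 0≤g) 0≤g-2))
                  (0≤* 0≤ab (0≤+ (0≤+ (0≤* (0≤* (0≤n 97) 0≤u-1) (0≤i*i g))
                                       (0≤* (0≤n 97) (0≤* 0≤g-2 (0≤+ 0≤g (0≤n 2)))))
                                 (0≤n 132)))

    32T³≤60abΔ[g+4] : + 32 * (T * (T * T)) ≤ + 60 * (a * b) * (Δ * (g + + 4))
    32T³≤60abΔ[g+4] = begin
      + 32 * (T * (T * T))                           ≡⟨ cong (λ z → + 32 * (T * z)) T²≡Δ+4ab ⟩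
      + 32 * (T * (Δ + + 4 * a * b))                 ≡⟨ solve (a ∷ b ∷ T ∷ Δ ∷ []) ⟩
      (+ 8 * T) * (+ 4 * Δ) + + 128 * (a * b) * T    ≤⟨ ℤP.+-mono-≤ (ℤP.*-monoʳ-≤-nonNeg (+ 4 * Δ) {{nonNegative (0≤* (0≤n 4) 0≤Δ)}} 8T≤15abg)
                                                                     (ℤP.*-monoˡ-≤-nonNeg (+ 128 * (a * b)) {{nonNegative (0≤* (0≤n 128) 0≤ab)}} T≤Δ) ⟩
      + 15 * (a * b) * g * (+ 4 * Δ) + + 128 * (a * b) * Δ ≤⟨ ≤-by-difference (+ 112 * (a * b) * Δ) (solve (a ∷ b ∷ g ∷ Δ ∷ [])) (0≤* (0≤* (0≤n 112) 0≤ab) 0≤Δ) ⟩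
      + 60 * (a * b) * (Δ * (g + + 4))               ∎

    module _ {c d : ℤ} (0<c : 0ℤ < c) (0<d : 0ℤ < d)
      (c-bound : + 2 * a * (c - + 1) ≤ T + g) (d-bound : + 2 * b * (d - + 1) ≤ T + g) where

      private
        2ca≤4T-of : ∀ {c a} → + 2 * a * (c - + 1) ≤ T + g → a < T → + 2 * c * a ≤ + 4 * T
        2ca≤4T-of {c} {a} bound a<T = begin
          + 2 * c * a                          ≡⟨ solve (a ∷ c ∷ []) ⟩
          + 2 * a * (c - + 1) + + 2 * a        ≤⟨ ℤP.+-mono-≤ bound (ℤP.*-monoˡ-≤-nonNeg (+ 2) (ℤP.<⇒≤ a<T)) ⟩
          T + g + + 2 * T                      ≤⟨ ℤP.+-monoˡ-≤ (+ 2 * T) (ℤP.+-monoʳ-≤ T (ℤP.<⇒≤ g<T)) ⟩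
          T + T + + 2 * T                      ≡⟨ solve (T ∷ []) ⟩
          + 4 * T                              ∎
        0≤2ca = 0≤* (0≤* (0≤n 2) (ℤP.<⇒≤ 0<c)) 0≤a
        0≤2db = 0≤* (0≤* (0≤n 2) (ℤP.<⇒≤ 0<d)) 0≤b
        0≤4T = 0≤* (0≤n 4) (ℤP.<⇒≤ 0<T)
        2ca≤4T = 2ca≤4T-of {c} c-bound a<T
        2db≤4T = 2ca≤4T-of {d} d-bound b<T

      4ab·form≤32T³ : + 4 * (a * b) * form a T b c d ≤ + 32 * (T * (T * T))
      4ab·form≤32T³ = begin
        + 4 * (a * b) * (c * c * a + c * d * T + d * d * b) ≡⟨ solve (a ∷ b ∷ c ∷ d ∷ T ∷ []) ⟩
        (+ 2 * c * a) * (+ 2 * c * a) * b + (+ 2 * c * a) * (+ 2 * d * b) * T + (+ 2 * d * b) * (+ 2 * d * b) * a ≤⟨ ℤP.+-mono-≤ (ℤP.+-mono-≤ (ℤP.*-monoʳ-≤-nonNeg b {{nonNegative 0≤b}} (*-mono-≤-nonNeg 0≤4T 0≤2ca 2ca≤4T 2ca≤4T))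
                                                                               (ℤP.*-monoʳ-≤-nonNeg T {{nonNegative (ℤP.<⇒≤ 0<T)}} (*-mono-≤-nonNeg 0≤4T 0≤2db 2ca≤4T 2db≤4T)))
                                                                  (ℤP.*-monoʳ-≤-nonNeg a {{nonNegative 0≤a}} (*-mono-≤-nonNeg 0≤4T 0≤2db 2db≤4T 2db≤4T)) ⟩
        (+ 4 * T) * (+ 4 * T) * b + (+ 4 * T) * (+ 4 * T) * T + (+ 4 * T) * (+ 4 * T) * a ≡⟨ solve (a ∷ b ∷ T ∷ []) ⟩
        + 16 * (T * T) * (a + b + T)               ≤⟨ ℤP.*-monoˡ-≤-nonNeg (+ 16 * (T * T)) {{nonNegative (0≤* (0≤n 16) (0≤i*i T))}} a+b+T≤2T ⟩
        + 16 * (T * T) * (+ 2 * T)                 ≡⟨ solve (T ∷ []) ⟩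
        + 32 * (T * (T * T))                       ∎
        where
        a+b+T≤2T : a + b + T ≤ + 2 * T
        a+b+T≤2T = ≤-by-difference (T - a - b) (solve (a ∷ b ∷ T ∷ [])) (ℤP.<⇒≤ 0<T-a-b)

      form≤15Δ[g+4] : form a T b c d ≤ + 15 * (Δ * (g + + 4))
      form≤15Δ[g+4] = *-cancelˡ-≤-pos (0<* (0<1+n 3) 0<ab) (begin
        + 4 * (a * b) * form a T b c d             ≤⟨ 4ab·form≤32T³ ⟩
        + 32 * (T * (T * T))                       ≤⟨ 32T³≤60abΔ[g+4] ⟩
        + 60 * (a * b) * (Δ * (g + + 4))           ≡⟨ solve (a ∷ b ∷ Δ ∷ g ∷ []) ⟩
        + 4 * (a * b) * (+ 15 * (Δ * (g + + 4)))   ∎)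

      form-bound : ∀ {s t m} → 0ℤ ≤ s → 0ℤ ≤ t → s < m * c → t < m * d → + 1 ≤ m →
        form a T b s t < + 4 * (m * m * (+ 2 * m + + 1) * (+ 2 * m + + 3)) * Δ
                         + m * m * (+ 2 * m + + 1) * (+ 2 * m + + 3) * (Δ + + 4) * g
      form-bound {s} {t} {m} 0≤s 0≤t s<mc t<md 1≤m = begin-strict
        form a T b s t                                     <⟨ ℤP.+-mono-<-≤ (ℤP.+-mono-<-≤ (*-monoʳ-<-pos 0<a (i*i<j*j 0≤s s<mc))
                                                                                          (ℤP.*-monoʳ-≤-nonNeg T {{nonNegative (ℤP.<⇒≤ 0<T)}} (*-mono-≤-nonNeg 0≤mc 0≤t (ℤP.<⇒≤ s<mc) (ℤP.<⇒≤ t<md))))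
                                                                            (ℤP.*-monoʳ-≤-nonNeg b {{nonNegative 0≤b}} (*-mono-≤-nonNeg 0≤md 0≤t (ℤP.<⇒≤ t<md) (ℤP.<⇒≤ t<md))) ⟩
        m * c * (m * c) * a + m * c * (m * d) * T + m * d * (m * d) * b ≡⟨ solve (a ∷ b ∷ c ∷ d ∷ m ∷ T ∷ []) ⟩
        m * m * (c * c * a + c * d * T + d * d * b)        ≤⟨ ℤP.*-monoˡ-≤-nonNeg (m * m) {{nonNegative (0≤i*i m)}} form≤15Δ[g+4] ⟩
        m * m * (+ 15 * (Δ * (g + + 4)))                   ≤⟨ ≤-by-difference _ (slack m g Δ) nonNeg ⟩
        + 4 * (m * m * (+ 2 * m + + 1) * (+ 2 * m + + 3)) * Δ + m * m * (+ 2 * m + + 1) * (+ 2 * m + + 3) * (Δ + + 4) * g ∎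
        where
        0≤m = ℤP.≤-trans (0≤n 1) 1≤m
        0≤mc = ℤP.≤-trans 0≤s (ℤP.<⇒≤ s<mc)
        0≤md = ℤP.≤-trans 0≤t (ℤP.<⇒≤ t<md)
        -- (2m+1)(2m+3) - 15 = 4(m-1)(m+3)
        slack : ∀ m g Δ → + 4 * (m * m * (+ 2 * m + + 1) * (+ 2 * m + + 3)) * Δ + m * m * (+ 2 * m + + 1) * (+ 2 * m + + 3) * (Δ + + 4) * g
                          - m * m * (+ 15 * (Δ * (g + + 4)))
                          ≡ m * m * (+ 4 * (m - + 1) * (m + + 3) * (Δ * (g + + 4)) + (+ 2 * m + + 1) * (+ 2 * m + + 3) * (+ 4 * g))
        slack = solve-∀
        nonNeg = 0≤* (0≤i*i m) (0≤+ (0≤* (0≤* (0≤* (0≤n 4) (ℤP.i≤j⇒0≤j-i 1≤m)) (0≤+ 0≤m (0≤n 3))) (0≤* 0≤Δ (0≤+ 0≤g (0≤n 4))))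
                                     (0≤* (0≤* (0≤+ (0≤* (0≤n 2) 0≤m) (0≤n 1)) (0≤+ (0≤* (0≤n 2) 0≤m) (0≤n 3))) (0≤* (0≤n 4) 0≤g)))

module Lattice where

  open import Defs using (OK; addOK; zeroOK; sumOK)
  open import Data.Nat as ℕ using (ℕ; zero; suc; NonZero)
  import Data.Nat.Properties as ℕP
  open import Data.Integer using (ℤ; +_; 0ℤ; 1ℤ; _+_; _*_; _-_; -_; ∣_∣)
  import Data.Integer.Properties as ℤP
  open import Data.Integer.DivMod using (_%ℕ_; _/ℕ_; a≡a%ℕn+[a/ℕn]*n; n%ℕd<d)
  open import Data.Integer.Tactic.RingSolver using (solve-∀)
  open import Data.List using ([]; _∷_; _++_; replicate; concat)
  open import Data.Empty using (⊥-elim)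
  open import Function using (_∘_)
  open import Data.Product using (_×_; _,_; proj₁; proj₂)
  open import Relation.Nullary using (¬_; yes; no)
  open import Relation.Binary.PropositionalEquality

  negOK : OK → OK
  negOK (a , b) = (- a , - b)

  subOK : OK → OK → OK
  subOK u v = addOK u (negOK v)

  scale : ℤ → OK → OK
  scale k (a , b) = (k * a , k * b)

  det : OK → OK → ℤ
  det (a , b) (c , d) = a * d - b * c

  addOK-comm : ∀ u v → addOK u v ≡ addOK v u
  addOK-comm (a , b) (c , d) = cong₂ _,_ (ℤP.+-comm a c) (ℤP.+-comm b d)

  addOK-assoc : ∀ u v w → addOK (addOK u v) w ≡ addOK u (addOK v w)
  addOK-assoc (a , b) (c , d) (e , f) = cong₂ _,_ (ℤP.+-assoc a c e) (ℤP.+-assoc b d f)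

  addOK-identityˡ : ∀ u → addOK zeroOK u ≡ u
  addOK-identityˡ (a , b) = cong₂ _,_ (ℤP.+-identityˡ a) (ℤP.+-identityˡ b)

  addOK-identityʳ : ∀ u → addOK u zeroOK ≡ u
  addOK-identityʳ (a , b) = cong₂ _,_ (ℤP.+-identityʳ a) (ℤP.+-identityʳ b)

  negOK-subOK : ∀ u v → negOK (subOK u v) ≡ subOK v u
  negOK-subOK (a , b) (c , d) = cong₂ _,_ (neg-sub a c) (neg-sub b d)
    where
    neg-sub : ∀ a c → - (a + - c) ≡ c + - a
    neg-sub = solve-∀

  addOK-subOK : ∀ u v → addOK v (subOK u v) ≡ u
  addOK-subOK (a , b) (c , d) = cong₂ _,_ (cancel a c) (cancel b d)
    where
    cancel : ∀ a c → c + (a + - c) ≡ a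
    cancel = solve-∀

  scale-+ : ∀ i j u → scale (i + j) u ≡ addOK (scale i u) (scale j u)
  scale-+ i j (a , b) = cong₂ _,_ (ℤP.*-distribʳ-+ a i j) (ℤP.*-distribʳ-+ b i j)

  scale-zero : ∀ u → scale 0ℤ u ≡ zeroOK
  scale-zero (a , b) = refl

  scale-suc : ∀ n u → scale (+ suc n) u ≡ addOK u (scale (+ n) u)
  scale-suc n (a , b) = cong₂ _,_ (distrib (+ n) a) (distrib (+ n) b)
    where
    distrib : ∀ n a → (+ 1 + n) * a ≡ a + n * a
    distrib = solve-∀

  sumOK-++ : ∀ xs ys → sumOK (xs ++ ys) ≡ addOK (sumOK xs) (sumOK ys)
  sumOK-++ [] ys = sym (addOK-identityˡ (sumOK ys))
  sumOK-++ (x ∷ xs) ys = trans (cong (addOK x) (sumOK-++ xs ys)) (sym (addOK-assoc x (sumOK xs) (sumOK ys)))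

  sumOK-replicate : ∀ n u → sumOK (replicate n u) ≡ scale (+ n) u
  sumOK-replicate zero u = sym (scale-zero u)
  sumOK-replicate (suc n) u = trans (cong (addOK u) (sumOK-replicate n u)) (sym (scale-suc n u))

  sumOK-concat-replicate : ∀ n xs → sumOK (concat (replicate n xs)) ≡ scale (+ n) (sumOK xs)
  sumOK-concat-replicate zero xs = sym (scale-zero (sumOK xs))
  sumOK-concat-replicate (suc n) xs = begin
    sumOK (xs ++ concat (replicate n xs))              ≡⟨ sumOK-++ xs (concat (replicate n xs)) ⟩
    addOK (sumOK xs) (sumOK (concat (replicate n xs))) ≡⟨ cong (addOK (sumOK xs)) (sumOK-concat-replicate n xs) ⟩
    addOK (sumOK xs) (scale (+ n) (sumOK xs))          ≡⟨ sym (scale-suc n (sumOK xs)) ⟩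
    scale (+ suc n) (sumOK xs)                         ∎
    where open ≡-Reasoning

  det-self : ∀ u → det u u ≡ 0ℤ
  det-self (a , b) = vanish a b
    where
    vanish : ∀ a b → a * b - b * a ≡ 0ℤ
    vanish = solve-∀

  det-zeroʳ : ∀ u → det u zeroOK ≡ 0ℤ
  det-zeroʳ (a , b) = vanish a b
    where
    vanish : ∀ a b → a * 0ℤ - b * 0ℤ ≡ 0ℤ
    vanish = solve-∀

  det-+ˡ : ∀ u v w → det (addOK u v) w ≡ det u w + det v w
  det-+ˡ (a , b) (c , d) (e , f) = expand a b c d e f
    where
    expand : ∀ a b c d e f → (a + c) * f - (b + d) * e ≡ (a * f - b * e) + (c * f - d * e)
    expand = solve-∀

  det-negʳ : ∀ u v → det u (negOK v) ≡ - det u v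
  det-negʳ (a , b) (c , d) = expand a b c d
    where
    expand : ∀ a b c d → a * (- d) - b * (- c) ≡ - (a * d - b * c)
    expand = solve-∀

  det-subOKʳ : ∀ w u v → det w (subOK u v) ≡ det w u + det v w
  det-subOKʳ (a , b) (c , d) (e , f) = expand a b c d e f
    where
    expand : ∀ a b c d e f → a * (d + - f) - b * (c + - e) ≡ (a * d - b * c) + (e * b - f * a)
    expand = solve-∀

  det-subOKˡ : ∀ u v w → det (subOK u v) w ≡ det u w + det w v
  det-subOKˡ (a , b) (c , d) (e , f) = expand a b c d e f
    where
    expand : ∀ a b c d e f → (a + - c) * f - (b + - d) * e ≡ (a * f - b * e) + (e * d - f * c)
    expand = solve-∀

  det-antisym : ∀ u v → det u v ≡ - det v u
  det-antisym (a , b) (c , d) = expand a b c d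
    where
    expand : ∀ a b c d → a * d - b * c ≡ - (c * b - d * a)
    expand = solve-∀

  cramer : ∀ α l μ → det l μ ≡ 1ℤ → α ≡ addOK (scale (det α μ) l) (scale (det l α) μ)
  cramer (x₁ , x₂) (l₁ , l₂) (m₁ , m₂) det≡1 = cong₂ _,_
    (trans (sym (ℤP.*-identityʳ x₁)) (trans (cong (x₁ *_) (sym det≡1)) (first x₁ x₂ l₁ l₂ m₁ m₂)))
    (trans (sym (ℤP.*-identityʳ x₂)) (trans (cong (x₂ *_) (sym det≡1)) (second x₁ x₂ l₁ l₂ m₁ m₂)))
    where
    first : ∀ x₁ x₂ l₁ l₂ m₁ m₂ → x₁ * (l₁ * m₂ - l₂ * m₁) ≡ (x₁ * m₂ - x₂ * m₁) * l₁ + (l₁ * x₂ - l₂ * x₁) * m₁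
    first = solve-∀
    second : ∀ x₁ x₂ l₁ l₂ m₁ m₂ → x₂ * (l₁ * m₂ - l₂ * m₁) ≡ (x₁ * m₂ - x₂ * m₁) * l₂ + (l₁ * x₂ - l₂ * x₁) * m₂
    second = solve-∀

  det-linearʳ : ∀ u s l t μ → det u (addOK (scale s l) (scale t μ)) ≡ s * det u l + t * det u μ
  det-linearʳ (a , b) s (c , d) t (e , f) = expand a b c d e f s t
    where
    expand : ∀ a b c d e f s t → a * (s * d + t * f) - b * (s * c + t * e) ≡ s * (a * d - b * c) + t * (a * f - b * e)
    expand = solve-∀

  det-linearˡ : ∀ u s l t μ → det (addOK (scale s l) (scale t μ)) u ≡ s * det l u + t * det μ u
  det-linearˡ (a , b) s (c , d) t (e , f) = expand a b c d e f s t
    where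
    expand : ∀ a b c d e f s t → (s * c + t * e) * b - (s * d + t * f) * a ≡ s * (c * b - d * a) + t * (e * b - f * a)
    expand = solve-∀

  det-scaleʳ : ∀ k u v → det u (scale k v) ≡ k * det u v
  det-scaleʳ k (a , b) (c , d) = expand k a b c d
    where
    expand : ∀ k a b c d → a * (k * d) - b * (k * c) ≡ k * (a * d - b * c)
    expand = solve-∀

  det-scaleˡ : ∀ k u v → det (scale k u) v ≡ k * det u v
  det-scaleˡ k (a , b) (c , d) = expand k a b c d
    where
    expand : ∀ k a b c d → k * a * d - k * b * c ≡ k * (a * d - b * c)
    expand = solve-∀

  record ParallelogramPoint (K : ℕ) (l μ : OK) : Set where
    field
      s t : ℕ
      s<K : s ℕ.< K
      t<K : t ℕ.< K
      nonzero : ¬ (s ≡ 0 × t ≡ 0)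
      p : OK
      K·p≡s·l+t·μ : scale (+ K) p ≡ addOK (scale (+ s) l) (scale (+ t) μ)

  module _ {K : ℕ} {{K≢0 : NonZero K}} where

    private
      reduce-coordinate : ∀ q l m A B → + K * q ≡ A * l + B * m →
        + K * (q + - ((A /ℕ K) * l + (B /ℕ K) * m)) ≡ + (A %ℕ K) * l + + (B %ℕ K) * m
      reduce-coordinate q l m A B Kq≡ = begin
        + K * (q + - (a * l + b * m))                              ≡⟨ expand (+ K) q l m a b ⟩
        + K * q - (a * + K * l + b * + K * m)                      ≡⟨ cong (_- (a * + K * l + b * + K * m)) Kq≡ ⟩
        A * l + B * m - (a * + K * l + b * + K * m)                ≡⟨ cong₂ (λ x y → x * l + y * m - (a * + K * l + b * + K * m))
                                                                            (a≡a%ℕn+[a/ℕn]*n A K) (a≡a%ℕn+[a/ℕn]*n B K) ⟩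
        (+ (A %ℕ K) + a * + K) * l + (+ (B %ℕ K) + b * + K) * m
          - (a * + K * l + b * + K * m)                            ≡⟨ cancel (+ (A %ℕ K)) (+ (B %ℕ K)) a b (+ K) l m ⟩
        + (A %ℕ K) * l + + (B %ℕ K) * m                            ∎
        where
        open ≡-Reasoning
        a = A /ℕ K
        b = B /ℕ K
        expand : ∀ K q l m a b → K * (q + - (a * l + b * m)) ≡ K * q - (a * K * l + b * K * m)
        expand = solve-∀
        cancel : ∀ r r' a b K l m → (r + a * K) * l + (r' + b * K) * m - (a * K * l + b * K * m) ≡ r * l + r' * m
        cancel = solve-∀

      multiple : ∀ A → A %ℕ K ≡ 0 → A ≡ (A /ℕ K) * + K
      multiple A A%K≡0 = trans (a≡a%ℕn+[a/ℕn]*n A K) (trans (cong (λ r → + r + (A /ℕ K) * + K) A%K≡0) (ℤP.+-identityˡ _))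

    reduce-modulo : ∀ {l μ} q A B → scale (+ K) q ≡ addOK (scale A l) (scale B μ) → ¬ (A %ℕ K ≡ 0 × B %ℕ K ≡ 0) →
      ParallelogramPoint K l μ
    reduce-modulo {l₁ , l₂} {m₁ , m₂} q@(q₁ , q₂) A B Kq≡ nonzero = record
      { s = A %ℕ K ; t = B %ℕ K ; s<K = n%ℕd<d A K ; t<K = n%ℕd<d B K ; nonzero = nonzero
      ; p = subOK q (addOK (scale (A /ℕ K) (l₁ , l₂)) (scale (B /ℕ K) (m₁ , m₂)))
      ; K·p≡s·l+t·μ = cong₂ _,_ (reduce-coordinate q₁ l₁ m₁ A B (cong proj₁ Kq≡))
                                (reduce-coordinate q₂ l₂ m₂ A B (cong proj₂ Kq≡)) }

    -- K ∣ l and K ∣ μ force K² ∣ det l μ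
    K∣coordinates⇒det≢K : ∀ {l₁ l₂ m₁ m₂} → 1 ℕ.< K → l₁ %ℕ K ≡ 0 → (- l₂) %ℕ K ≡ 0 → (- m₁) %ℕ K ≡ 0 → m₂ %ℕ K ≡ 0 →
      det (l₁ , l₂) (m₁ , m₂) ≢ + K
    K∣coordinates⇒det≢K {l₁ = l₁} {l₂ = l₂} {m₁ = m₁} {m₂ = m₂} 1<K r₁ r₂ r₃ r₄ det≡K =
      ℕP.<⇒≢ 1<K (sym (ℕP.m*n≡1⇒n≡1 ∣ z ∣ K (trans (sym (ℤP.abs-* z (+ K))) (cong ∣_∣ (sym 1≡zK)))))
      where
      z = (l₁ /ℕ K) * (m₂ /ℕ K) - ((- l₂) /ℕ K) * ((- m₁) /ℕ K)
      negate : ∀ A → - A ≡ ((- A) /ℕ K) * + K → A ≡ - (((- A) /ℕ K) * + K)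
      negate A eq = trans (sym (ℤP.neg-involutive A)) (cong -_ eq)
      expand : ∀ a b c d K → a * K * (d * K) - (- (b * K)) * (- (c * K)) ≡ K * ((a * d - b * c) * K)
      expand = solve-∀
      K≡K·zK : + K ≡ + K * (z * + K)
      K≡K·zK = begin
        + K                   ≡⟨ sym det≡K ⟩
        l₁ * m₂ - l₂ * m₁     ≡⟨ cong₂ (λ x y → x * y - l₂ * m₁) (multiple l₁ r₁) (multiple m₂ r₄) ⟩
        (l₁ /ℕ K) * + K * ((m₂ /ℕ K) * + K) - l₂ * m₁
                              ≡⟨ cong₂ (λ x y → (l₁ /ℕ K) * + K * ((m₂ /ℕ K) * + K) - x * y)
                                       (negate l₂ (multiple (- l₂) r₂)) (negate m₁ (multiple (- m₁) r₃)) ⟩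
        (l₁ /ℕ K) * + K * ((m₂ /ℕ K) * + K) - (- (((- l₂) /ℕ K) * + K)) * (- (((- m₁) /ℕ K) * + K))
                              ≡⟨ expand (l₁ /ℕ K) ((- l₂) /ℕ K) ((- m₁) /ℕ K) (m₂ /ℕ K) (+ K) ⟩
        + K * (z * + K)       ∎
        where open ≡-Reasoning
      1≡zK : 1ℤ ≡ z * + K
      1≡zK = ℤP.*-cancelˡ-≡ (+ K) 1ℤ (z * + K) (trans (ℤP.*-identityʳ (+ K)) K≡K·zK)

  -- Reduce the rows of the adjugate, K·(1,0) = m₂ l - l₂ μ and K·(0,1) = -m₁ l + l₁ μ, modulo K.
  parallelogram-point : ∀ {K l μ} → det l μ ≡ + K → 1 ℕ.< K → ParallelogramPoint K l μ
  parallelogram-point {K} {l@(l₁ , l₂)} {μ@(m₁ , m₂)} det≡K 1<K = point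
    where
    instance
      K≢0 : NonZero K
      K≢0 = ℕ.>-nonZero (ℕP.<-trans (ℕ.s≤s ℕ.z≤n) 1<K)

    adjugate₁ : scale (+ K) (1ℤ , 0ℤ) ≡ addOK (scale m₂ l) (scale (- l₂) μ)
    adjugate₁ = cong₂ _,_ (trans (ℤP.*-identityʳ (+ K)) (trans (sym det≡K) (expand₁ l₁ l₂ m₁ m₂))) (expand₂ l₂ m₂ (+ K))
      where
      expand₁ : ∀ l₁ l₂ m₁ m₂ → l₁ * m₂ - l₂ * m₁ ≡ m₂ * l₁ + - l₂ * m₁
      expand₁ = solve-∀
      expand₂ : ∀ l₂ m₂ K → K * 0ℤ ≡ m₂ * l₂ + - l₂ * m₂
      expand₂ = solve-∀

    adjugate₂ : scale (+ K) (0ℤ , 1ℤ) ≡ addOK (scale (- m₁) l) (scale l₁ μ)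
    adjugate₂ = cong₂ _,_ (expand₁ l₁ m₁ (+ K)) (trans (ℤP.*-identityʳ (+ K)) (trans (sym det≡K) (expand₂ l₁ l₂ m₁ m₂)))
      where
      expand₁ : ∀ l₁ m₁ K → K * 0ℤ ≡ - m₁ * l₁ + l₁ * m₁
      expand₁ = solve-∀
      expand₂ : ∀ l₁ l₂ m₁ m₂ → l₁ * m₂ - l₂ * m₁ ≡ - m₁ * l₂ + l₁ * m₂
      expand₂ = solve-∀

    point : ParallelogramPoint K l μ
    point with m₂ %ℕ K ℕ.≟ 0 | (- l₂) %ℕ K ℕ.≟ 0
    ... | no r | _ = reduce-modulo (1ℤ , 0ℤ) m₂ (- l₂) adjugate₁ (r ∘ proj₁)
    ... | yes _ | no r = reduce-modulo (1ℤ , 0ℤ) m₂ (- l₂) adjugate₁ (r ∘ proj₂)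
    ... | yes r₄ | yes r₂ with (- m₁) %ℕ K ℕ.≟ 0 | l₁ %ℕ K ℕ.≟ 0
    ...   | no r | _ = reduce-modulo (0ℤ , 1ℤ) (- m₁) l₁ adjugate₂ (r ∘ proj₁)
    ...   | yes _ | no r = reduce-modulo (0ℤ , 1ℤ) (- m₁) l₁ adjugate₂ (r ∘ proj₂)
    ...   | yes r₃ | yes r₁ = ⊥-elim (K∣coordinates⇒det≢K {l₁ = l₁} {l₂ = l₂} {m₁ = m₁} {m₂ = m₂} 1<K r₁ r₂ r₃ r₄ det≡K)

module Coordinates (D : ℕ) where

  open import Defs using (OK; addOK; zeroOK; twiceX; twiceY; norm; disc; oneMod4)
  open import Data.Nat.DivMod using (_%_; _/_; m≡m%n+[m/n]*n; m*n/n≡m)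
  open import Data.Integer using (ℤ; +_; 0ℤ; 1ℤ; _+_; _*_; _-_; -_; _<_; +<+)
  import Data.Integer.Properties as ℤP
  open import Data.Integer.Tactic.RingSolver using (solve-∀)
  open import Data.Bool using (true; false)
  open import Data.Product using (_,_)
  open import Relation.Nullary using (Dec; does; yes; no)
  open import Relation.Binary.PropositionalEquality
  open Lattice

  X Y : OK → ℤ
  X = twiceX D
  Y = twiceY D

  -- 2(a + bω) = X + Y√D with X = 2a + ξb and Y = ηb
  ξ η : ℤ
  ξ with oneMod4 D
  ... | true = 1ℤ
  ... | false = 0ℤ
  η with oneMod4 D
  ... | true = 1ℤ
  ... | false = + 2

  X-form : ∀ a b → X (a , b) ≡ + 2 * a + ξ * b
  X-form a b with oneMod4 D
  ... | true = cong (_+_ (+ 2 * a)) (sym (ℤP.*-identityˡ b))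
  ... | false = sym (trans (cong (_+_ (+ 2 * a)) (ℤP.*-zeroˡ b)) (ℤP.+-identityʳ (+ 2 * a)))

  Y-form : ∀ a b → Y (a , b) ≡ η * b
  Y-form a b with oneMod4 D
  ... | true = sym (ℤP.*-identityˡ b)
  ... | false = refl

  X-+ : ∀ u v → X (addOK u v) ≡ X u + X v
  X-+ (a , b) (c , d) rewrite X-form (a + c) (b + d) | X-form a b | X-form c d = expand a b c d ξ
    where
    expand : ∀ a b c d ξ → + 2 * (a + c) + ξ * (b + d) ≡ (+ 2 * a + ξ * b) + (+ 2 * c + ξ * d)
    expand = solve-∀

  Y-+ : ∀ u v → Y (addOK u v) ≡ Y u + Y v
  Y-+ (a , b) (c , d) rewrite Y-form (a + c) (b + d) | Y-form a b | Y-form c d = ℤP.*-distribˡ-+ η b d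

  X-neg : ∀ u → X (negOK u) ≡ - X u
  X-neg (a , b) rewrite X-form (- a) (- b) | X-form a b = expand a b ξ
    where
    expand : ∀ a b ξ → + 2 * (- a) + ξ * (- b) ≡ - (+ 2 * a + ξ * b)
    expand = solve-∀

  Y-neg : ∀ u → Y (negOK u) ≡ - Y u
  Y-neg (a , b) rewrite Y-form (- a) (- b) | Y-form a b = sym (ℤP.neg-distribʳ-* η b)

  X-scale : ∀ k u → X (scale k u) ≡ k * X u
  X-scale k (a , b) rewrite X-form (k * a) (k * b) | X-form a b = expand k a b ξ
    where
    expand : ∀ k a b ξ → + 2 * (k * a) + ξ * (k * b) ≡ k * (+ 2 * a + ξ * b)
    expand = solve-∀

  Y-scale : ∀ k u → Y (scale k u) ≡ k * Y u
  Y-scale k (a , b) rewrite Y-form (k * a) (k * b) | Y-form a b = expand k b η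
    where
    expand : ∀ k b η → η * (k * b) ≡ k * (η * b)
    expand = solve-∀

  -- Q u = 4 N(u) and B u v = 2 Tr(u v')
  Q : OK → ℤ
  Q u = X u * X u - + D * Y u * Y u

  B : OK → OK → ℤ
  B u v = X u * X v - + D * Y u * Y v

  oneMod4⇒D≡1+4c : oneMod4 D ≡ true → D ≡ 1 ℕ.+ ((D ℕ.∸ 1) / 4) ℕ.* 4
  oneMod4⇒D≡1+4c eq = trans D≡1+[D/4]*4 (cong (λ z → 1 ℕ.+ z ℕ.* 4) (sym [D-1]/4≡D/4))
    where
    witness : ∀ {P : Set} (P? : Dec P) → does P? ≡ true → P
    witness (yes p) _ = p
    witness (no _) ()
    D≡1+[D/4]*4 : D ≡ 1 ℕ.+ (D / 4) ℕ.* 4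
    D≡1+[D/4]*4 = trans (m≡m%n+[m/n]*n D 4) (cong (ℕ._+ (D / 4) ℕ.* 4) (witness (D % 4 ℕ.≟ 1) eq))
    [D-1]/4≡D/4 : (D ℕ.∸ 1) / 4 ≡ D / 4
    [D-1]/4≡D/4 = trans (cong (_/ 4) (cong (ℕ._∸ 1) D≡1+[D/4]*4)) (m*n/n≡m (D / 4) 4)

  Q≡4·norm : ∀ u → Q u ≡ + 4 * norm D u
  Q≡4·norm (a , b) with oneMod4 D in eq
  ... | true = begin
    (+ 2 * a + b) * (+ 2 * a + b) - + D * b * b                 ≡⟨ cong (λ d → (+ 2 * a + b) * (+ 2 * a + b) - d * b * b) D≡ ⟩
    (+ 2 * a + b) * (+ 2 * a + b) - (1ℤ + c * + 4) * b * b      ≡⟨ expand a b c ⟩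
    + 4 * (a * a + a * b - b * b * c)                           ∎
    where
    open ≡-Reasoning
    c = + ((D ℕ.∸ 1) / 4)
    D≡ : + D ≡ 1ℤ + c * + 4
    D≡ = trans (cong +_ (oneMod4⇒D≡1+4c eq)) (trans (ℤP.pos-+ 1 _) (cong (_+_ 1ℤ) (ℤP.pos-* ((D ℕ.∸ 1) / 4) 4)))
    expand : ∀ a b c → (+ 2 * a + b) * (+ 2 * a + b) - (1ℤ + c * + 4) * b * b ≡ + 4 * (a * a + a * b - b * b * c)
    expand = solve-∀
  ... | false = expand a b (+ D)
    where
    expand : ∀ a b d → (+ 2 * a) * (+ 2 * a) - d * (+ 2 * b) * (+ 2 * b) ≡ + 4 * (a * a - d * b * b)
    expand = solve-∀

  disc≡Dη² : + disc D ≡ + D * η * η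
  disc≡Dη² with oneMod4 D
  ... | true = sym (trans (ℤP.*-identityʳ (+ D * 1ℤ)) (ℤP.*-identityʳ (+ D)))
  ... | false = trans (ℤP.pos-* 4 D) (expand (+ D))
    where
    expand : ∀ d → + 4 * d ≡ d * + 2 * + 2
    expand = solve-∀

  B-sym : ∀ u v → B u v ≡ B v u
  B-sym u v = expand (X u) (Y u) (X v) (Y v) (+ D)
    where
    expand : ∀ x y x' y' d → x * x' - d * y * y' ≡ x' * x - d * y' * y
    expand = solve-∀

  B-+ˡ : ∀ u v w → B (addOK u v) w ≡ B u w + B v w
  B-+ˡ u v w rewrite X-+ u v | Y-+ u v = expand (X u) (Y u) (X v) (Y v) (X w) (Y w) (+ D)
    where
    expand : ∀ x₁ y₁ x₂ y₂ x₃ y₃ d → (x₁ + x₂) * x₃ - d * (y₁ + y₂) * y₃ ≡ (x₁ * x₃ - d * y₁ * y₃) + (x₂ * x₃ - d * y₂ * y₃)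
    expand = solve-∀

  B-scaleˡ : ∀ k u w → B (scale k u) w ≡ k * B u w
  B-scaleˡ k u w rewrite X-scale k u | Y-scale k u = expand k (X u) (Y u) (X w) (Y w) (+ D)
    where
    expand : ∀ k x y x' y' d → (k * x) * x' - d * (k * y) * y' ≡ k * (x * x' - d * y * y')
    expand = solve-∀

  B-negˡ : ∀ u w → B (negOK u) w ≡ - B u w
  B-negˡ u w rewrite X-neg u | Y-neg u = expand (X u) (Y u) (X w) (Y w) (+ D)
    where
    expand : ∀ x y x' y' d → (- x) * x' - d * (- y) * y' ≡ - (x * x' - d * y * y')
    expand = solve-∀

  Q-+ : ∀ u v → Q (addOK u v) ≡ Q u + Q v + + 2 * B u v
  Q-+ u v rewrite X-+ u v | Y-+ u v = expand (X u) (Y u) (X v) (Y v) (+ D)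
    where
    expand : ∀ x y x' y' d → (x + x') * (x + x') - d * (y + y') * (y + y') ≡
      (x * x - d * y * y) + (x' * x' - d * y' * y') + + 2 * (x * x' - d * y * y')
    expand = solve-∀

  Q-neg : ∀ u → Q (negOK u) ≡ Q u
  Q-neg u rewrite X-neg u | Y-neg u = expand (X u) (Y u) (+ D)
    where
    expand : ∀ x y d → (- x) * (- x) - d * (- y) * (- y) ≡ x * x - d * y * y
    expand = solve-∀

  Q-scale : ∀ k u → Q (scale k u) ≡ k * k * Q u
  Q-scale k u rewrite X-scale k u | Y-scale k u = expand k (X u) (Y u) (+ D)
    where
    expand : ∀ k x y d → (k * x) * (k * x) - d * (k * y) * (k * y) ≡ k * k * (x * x - d * y * y)
    expand = solve-∀

  XY-det : ∀ u v → X u * Y v - X v * Y u ≡ + 2 * η * det u v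
  XY-det (a , b) (c , d) rewrite X-form a b | X-form c d | Y-form a b | Y-form c d = expand a b c d ξ η
    where
    expand : ∀ a b c d ξ η → (+ 2 * a + ξ * b) * (η * d) - (+ 2 * c + ξ * d) * (η * b) ≡ + 2 * η * (a * d - b * c)
    expand = solve-∀

  lagrange : ∀ u v → B u v * B u v - Q u * Q v ≡ + D * ((X u * Y v - X v * Y u) * (X u * Y v - X v * Y u))
  lagrange u v = expand (X u) (Y u) (X v) (Y v) (+ D)
    where
    expand : ∀ x y x' y' d → (x * x' - d * y * y') * (x * x' - d * y * y') - (x * x - d * y * y) * (x' * x' - d * y' * y') ≡
      d * ((x * y' - x' * y) * (x * y' - x' * y))
    expand = solve-∀

  XY-injective : ∀ w → X w ≡ 0ℤ → Y w ≡ 0ℤ → w ≡ zeroOK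
  XY-injective (a , b) X≡0 Y≡0 = cong₂ _,_ a≡0 b≡0
    where
    η-cancel : ∀ {b} → η * b ≡ 0ℤ → b ≡ 0ℤ
    η-cancel {b} ηb≡0 with oneMod4 D
    ... | true = trans (sym (ℤP.*-identityˡ b)) ηb≡0
    ... | false = ℤP.*-cancelˡ-≡ (+ 2) b 0ℤ ηb≡0
    b≡0 : b ≡ 0ℤ
    b≡0 = η-cancel (trans (sym (Y-form a b)) Y≡0)
    a≡0 : a ≡ 0ℤ
    a≡0 = ℤP.*-cancelˡ-≡ (+ 2) a 0ℤ (begin
      + 2 * a                ≡⟨ sym (ℤP.+-identityʳ (+ 2 * a)) ⟩
      + 2 * a + 0ℤ           ≡⟨ cong (λ z → + 2 * a + z) (sym (trans (cong (ξ *_) b≡0) (ℤP.*-zeroʳ ξ))) ⟩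
      + 2 * a + ξ * b        ≡⟨ sym (X-form a b) ⟩
      X (a , b)              ≡⟨ X≡0 ⟩
      0ℤ                     ∎)
      where open ≡-Reasoning

  0<η : 0ℤ < η
  0<η with oneMod4 D
  ... | true = +<+ (ℕ.s≤s ℕ.z≤n)
  ... | false = +<+ (ℕ.s≤s ℕ.z≤n)

module TotalPositivity (D : ℕ) (2≤D : 2 ℕ.≤ D) where

  open import Data.Nat using (zero; suc)
  open import Defs using (OK; addOK; zeroOK; TotPos; disc; oneMod4)
  import Data.Nat.Properties as ℕP
  open import Data.Nat.DivMod using (_/_)
  open import Data.Integer using (ℤ; +_; 0ℤ; 1ℤ; _+_; _*_; _-_; -_; _<_; _≤_; +<+)
  import Data.Integer.Properties as ℤP
  open import Data.Integer.Tactic.RingSolver using (solve-∀)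
  open import Data.Bool using (true; false)
  open import Data.Empty using (⊥-elim)
  open import Data.Sum using (_⊎_; inj₁; inj₂; [_,_]′)
  open import Data.Product using (_×_; _,_; proj₁; proj₂)
  open import Function using (id; _∘_)
  open import Relation.Nullary using (¬_; Dec; yes; no)
  open import Relation.Binary.PropositionalEquality
  open IntegerInequalities
  open Lattice
  open Coordinates D

  private variable u v w : OK

  0<D : 0ℤ < + D
  0<D = +<+ (ℕP.<-≤-trans (ℕ.s≤s ℕ.z≤n) 2≤D)

  0<Q : TotPos D u → 0ℤ < Q u
  0<Q (_ , DY²<X²) = <⇒0<- DY²<X²

  totPos : 0ℤ < X u → 0ℤ < Q u → TotPos D u
  totPos 0<X 0<Q = 0<X , 0<-⇒< 0<Q

  totPos? : ∀ u → Dec (TotPos D u)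
  totPos? u with 0ℤ ℤP.<? X u | + D * Y u * Y u ℤP.<? X u * X u
  ... | yes 0<X | yes DY²<X² = yes (0<X , DY²<X²)
  ... | no 0≮X | _ = no (0≮X ∘ proj₁)
  ... | yes _ | no DY²≮X² = no (DY²≮X² ∘ proj₂)

  X≡0⇒¬0<Q : X w ≡ 0ℤ → ¬ (0ℤ < Q w)
  X≡0⇒¬0<Q {w} X≡0 0<Q = 0≤i⇒¬0<-i (0≤* (ℤP.<⇒≤ 0<D) (0≤i*i (Y w))) (subst (0ℤ <_) Q≡-DY² 0<Q)
    where
    expand : ∀ y d → 0ℤ * 0ℤ - d * y * y ≡ - (d * (y * y))
    expand = solve-∀
    Q≡-DY² : Q w ≡ - (+ D * (Y w * Y w))
    Q≡-DY² = trans (cong (λ x → x * x - + D * Y w * Y w) X≡0) (expand (Y w) (+ D))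

  0<Q⇒±totPos : 0ℤ < Q w → TotPos D w ⊎ TotPos D (negOK w)
  0<Q⇒±totPos {w} 0<Q with sign-trichotomy (X w)
  ... | inj₁ 0<X = inj₁ (totPos 0<X 0<Q)
  ... | inj₂ (inj₁ X≡0) = ⊥-elim (X≡0⇒¬0<Q X≡0 0<Q)
  ... | inj₂ (inj₂ 0<-X) = inj₂ (totPos (subst (0ℤ <_) (sym (X-neg w)) 0<-X) (subst (0ℤ <_) (sym (Q-neg w)) 0<Q))

  -- (X u X v)² - (D Y u Y v)² = Q u (X v)² + D (Y u)² Q v
  0<B : TotPos D u → TotPos D v → 0ℤ < B u v
  0<B {u} {v} tu@(0<Xu , _) tv@(0<Xv , _) = <⇒0<- (i*i<j*j⇒i<j (0<* 0<Xu 0<Xv) (<-by-difference _ (expand (X u) (Y u) (X v) (Y v) (+ D)) 0<rhs))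
    where
    expand : ∀ x y x' y' d → (x * x') * (x * x') - (d * y * y') * (d * y * y') ≡
      (x * x - d * y * y) * (x' * x') + (d * (y * y)) * (x' * x' - d * y' * y')
    expand = solve-∀
    0<rhs = 0<+ (0<* (0<Q tu) (0<* 0<Xv 0<Xv)) (0≤* (0≤* (ℤP.<⇒≤ 0<D) (0≤i*i (Y u))) (ℤP.<⇒≤ (0<Q tv)))

  totPos-+ : TotPos D u → TotPos D v → TotPos D (addOK u v)
  totPos-+ {u} {v} tu tv = totPos
    (subst (0ℤ <_) (sym (X-+ u v)) (0<+ (proj₁ tu) (ℤP.<⇒≤ (proj₁ tv))))
    (subst (0ℤ <_) (sym (Q-+ u v)) (0<+ (0<+ (0<Q tu) (ℤP.<⇒≤ (0<Q tv))) (0≤* (0≤n 2) (ℤP.<⇒≤ (0<B tu tv)))))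

  totPos-scale : ∀ n → TotPos D u → TotPos D (scale (+ suc n) u)
  totPos-scale {u} n tu = totPos
    (subst (0ℤ <_) (sym (X-scale (+ suc n) u)) (0<* (0<1+n n) (proj₁ tu)))
    (subst (0ℤ <_) (sym (Q-scale (+ suc n) u)) (0<* (0<* (0<1+n n) (0<1+n n)) (0<Q tu)))

  totPos-scale⁻¹ : ∀ n → TotPos D (scale (+ suc n) u) → TotPos D u
  totPos-scale⁻¹ {u} n tku = totPos
    (0<*⇒0< (0<1+n n) (subst (0ℤ <_) (X-scale (+ suc n) u) (proj₁ tku)))
    (0<*⇒0< (0<* (0<1+n n) (0<1+n n)) (subst (0ℤ <_) (Q-scale (+ suc n) u) (0<Q tku)))

  totPos-combination : ∀ s t {l μ} → TotPos D l → TotPos D μ →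
    TotPos D (addOK (scale (+ s) l) (scale (+ t) μ)) ⊎ (s ≡ 0 × t ≡ 0)
  totPos-combination zero zero _ _ = inj₂ (refl , refl)
  totPos-combination zero (suc t) {l} {μ} _ tμ = inj₁ (subst (TotPos D) (sym (addOK-identityˡ (scale (+ suc t) μ))) (totPos-scale t tμ))
  totPos-combination (suc s) zero {l} {μ} tl _ = inj₁ (subst (TotPos D) (sym (addOK-identityʳ (scale (+ suc s) l))) (totPos-scale s tl))
  totPos-combination (suc s) (suc t) tl tμ = inj₁ (totPos-+ (totPos-scale s tl) (totPos-scale t tμ))

  totPos⇒≢0 : TotPos D u → u ≢ zeroOK
  totPos⇒≢0 (0<X , _) refl = ℤP.<-irrefl (sym X-zero) 0<X
    where
    X-zero : X zeroOK ≡ 0ℤ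
    X-zero = trans (X-form 0ℤ 0ℤ) (expand ξ)
      where
      expand : ∀ ξ → + 2 * 0ℤ + ξ * 0ℤ ≡ 0ℤ
      expand = solve-∀

  X-subOK<X : ∀ u → TotPos D v → X (subOK u v) < X u
  X-subOK<X {v} u (0<Xv , _) = <-by-difference (X v) X-difference 0<Xv
    where
    cancel : ∀ x y → x - (x + - y) ≡ y
    cancel = solve-∀
    X-difference : X u - X (subOK u v) ≡ X v
    X-difference = trans (cong (λ z → X u - z) (trans (X-+ u (negOK v)) (cong (_+_ (X u)) (X-neg v)))) (cancel (X u) (X v))

  -- D (X u Y w - X w Y u)(X u Y w + X w Y u) = (X u)² (-Q w) + (X w)² Q u  >  0
  0<det : TotPos D u → 0ℤ < - Q w → 0ℤ < Y w → 0ℤ < det u w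
  0<det {u} {w} tu@(0<Xu , _) 0<-Qw 0<Yw = 0<*⇒0< (0<* (0<1+n 1) 0<η) (subst (0ℤ <_) (XY-det u w) 0<detXY)
    where
    expand : ∀ x y x' y' d → d * ((x * y') * (x * y') - (x' * y) * (x' * y)) ≡
      (x * x) * (- (x' * x' - d * y' * y')) + (x' * x') * (x * x - d * y * y)
    expand = solve-∀
    0<D·diff : 0ℤ < + D * ((X u * Y w) * (X u * Y w) - (X w * Y u) * (X w * Y u))
    0<D·diff = subst (0ℤ <_) (sym (expand (X u) (Y u) (X w) (Y w) (+ D)))
      (0<+ (0<* (0<* 0<Xu 0<Xu) 0<-Qw) (0≤* (0≤i*i (X w)) (ℤP.<⇒≤ (0<Q tu))))
    0<detXY : 0ℤ < X u * Y w - X w * Y u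
    0<detXY = <⇒0<- (i*i<j*j⇒i<j (0<* 0<Xu 0<Yw) (0<-⇒< (0<*⇒0< 0<D 0<D·diff)))

  totPos-1 : TotPos D (1ℤ , 0ℤ)
  totPos-1 = totPos {1ℤ , 0ℤ} (subst (0ℤ <_) (sym X≡2) (0<1+n 1)) (subst (0ℤ <_) (sym Q≡4) (0<1+n 3))
    where
    expand₁ : ∀ ξ → + 2 * 1ℤ + ξ * 0ℤ ≡ + 2
    expand₁ = solve-∀
    X≡2 : X (1ℤ , 0ℤ) ≡ + 2
    X≡2 = trans (X-form 1ℤ 0ℤ) (expand₁ ξ)
    expand₂ : ∀ η d → + 2 * + 2 - d * (η * 0ℤ) * (η * 0ℤ) ≡ + 4
    expand₂ = solve-∀
    Q≡4 : Q (1ℤ , 0ℤ) ≡ + 4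
    Q≡4 = trans (cong₂ (λ x y → x * x - + D * y * y) X≡2 (Y-form 1ℤ 0ℤ)) (expand₂ η (+ D))

  totPos-D+ω : TotPos D (+ D , 1ℤ)
  totPos-D+ω = totPos {+ D , 1ℤ} (subst (0ℤ <_) (sym X≡) 0<2D+ξ) (subst (0ℤ <_) (sym Q≡) 0<Q')
    where
    X≡ : X (+ D , 1ℤ) ≡ + 2 * + D + ξ
    X≡ = trans (X-form (+ D) 1ℤ) (cong (_+_ (+ 2 * + D)) (ℤP.*-identityʳ ξ))
    Q≡ : Q (+ D , 1ℤ) ≡ (+ 2 * + D + ξ) * (+ 2 * + D + ξ) - + D * η * η
    Q≡ = cong₂ (λ x y → x * x - + D * y * y) X≡ (trans (Y-form (+ D) 1ℤ) (ℤP.*-identityʳ η))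
    0<2D+ξ : 0ℤ < + 2 * + D + ξ
    0<2D+ξ with oneMod4 D
    ... | true = 0<+ (0<* (0<1+n 1) 0<D) (0≤n 1)
    ... | false = 0<+ (0<* (0<1+n 1) 0<D) (0≤n 0)
    0<Q' : 0ℤ < (+ 2 * + D + ξ) * (+ 2 * + D + ξ) - + D * η * η
    0<Q' with oneMod4 D
    ... | true = <-by-difference _ (expand₁ (+ D)) (0<+ (0<* (0<1+n 3) (0<* 0<D 0<D)) (0≤+ (0≤* (0≤n 3) (ℤP.<⇒≤ 0<D)) (0≤n 1)))
      where
      expand₁ : ∀ d → (+ 2 * d + 1ℤ) * (+ 2 * d + 1ℤ) - d * 1ℤ * 1ℤ - 0ℤ ≡ + 4 * (d * d) + (+ 3 * d + 1ℤ)
      expand₁ = solve-∀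
    ... | false = <-by-difference _ (expand₂ (+ D)) (0<* (0<* (0<1+n 3) 0<D) (<⇒0<- (+<+ 2≤D)))
      where
      expand₂ : ∀ d → (+ 2 * d + 0ℤ) * (+ 2 * d + 0ℤ) - d * + 2 * + 2 - 0ℤ ≡ + 4 * d * (d - 1ℤ)
      expand₂ = solve-∀

  5≤disc : 5 ℕ.≤ disc D
  5≤disc with oneMod4 D in eq
  ... | true = 5≤1+4c ((D ℕ.∸ 1) / 4) (oneMod4⇒D≡1+4c eq)
    where
    5≤1+4c : ∀ c → D ≡ 1 ℕ.+ c ℕ.* 4 → 5 ℕ.≤ D
    5≤1+4c zero D≡1 = ⊥-elim (ℕP.<⇒≢ 2≤D (sym D≡1))
    5≤1+4c (suc c) D≡5+4c = subst (5 ℕ.≤_) (sym D≡5+4c) (ℕ.s≤s (ℕ.s≤s (ℕ.s≤s (ℕ.s≤s (ℕ.s≤s ℕ.z≤n)))))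
  ... | false = ℕP.≤-trans (ℕ.s≤s (ℕ.s≤s (ℕ.s≤s (ℕ.s≤s (ℕ.s≤s ℕ.z≤n))))) (ℕP.*-monoʳ-≤ 4 2≤D)

  X<X-+ : ∀ u → TotPos D v → X u < X (addOK u v)
  X<X-+ {v} u (0<Xv , _) = <-by-difference (X v) X-difference 0<Xv
    where
    cancel : ∀ x y → x + y - x ≡ y
    cancel = solve-∀
    X-difference : X (addOK u v) - X u ≡ X v
    X-difference = trans (cong (_- X u) (X-+ u v)) (cancel (X u) (X v))

  Y≡0⇒¬0<-Q : Y w ≡ 0ℤ → ¬ (0ℤ < - Q w)
  Y≡0⇒¬0<-Q {w} Y≡0 = 0≤i⇒¬0<-i (subst (0ℤ ≤_) (sym Q≡X²) (0≤i*i (X w)))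
    where
    expand : ∀ x d → x * x - d * 0ℤ * 0ℤ ≡ x * x
    expand = solve-∀
    Q≡X² : Q w ≡ X w * X w
    Q≡X² = trans (cong (λ y → X w * X w - + D * y * y) Y≡0) (expand (X w) (+ D))

  module _ {l μ : OK} {a b T : ℤ} (Ql≡4a : Q l ≡ + 4 * a) (Qμ≡4b : Q μ ≡ + 4 * b) (Blμ≡2T : B l μ ≡ + 2 * T) where

    B[c·l-μ,l] : ∀ c → B (subOK (scale c l) μ) l ≡ + 2 * (+ 2 * a * c - T)
    B[c·l-μ,l] c = begin
      B (subOK (scale c l) μ) l                  ≡⟨ B-+ˡ (scale c l) (negOK μ) l ⟩
      B (scale c l) l + B (negOK μ) l            ≡⟨ cong₂ _+_ (B-scaleˡ c l l) (B-negˡ μ l) ⟩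
      c * Q l + - B μ l                          ≡⟨ cong₂ (λ x y → c * x + - y) Ql≡4a (trans (B-sym μ l) Blμ≡2T) ⟩
      c * (+ 4 * a) + - (+ 2 * T)                ≡⟨ expand a c T ⟩
      + 2 * (+ 2 * a * c - T)                    ∎
      where
      open ≡-Reasoning
      expand : ∀ a c T → c * (+ 4 * a) + - (+ 2 * T) ≡ + 2 * (+ 2 * a * c - T)
      expand = solve-∀

    a·Q[c·l-μ] : ∀ c → a * Q (subOK (scale c l) μ) ≡ (+ 2 * a * c - T) * (+ 2 * a * c - T) - (T * T - + 4 * a * b)
    a·Q[c·l-μ] c = begin
      a * Q (subOK (scale c l) μ)                                       ≡⟨ cong (a *_) (Q-+ (scale c l) (negOK μ)) ⟩
      a * (Q (scale c l) + Q (negOK μ) + + 2 * B (scale c l) (negOK μ)) ≡⟨ cong₂ (λ x y → a * (x + y + + 2 * B (scale c l) (negOK μ)))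
                                                                                  (trans (Q-scale c l) (cong (c * c *_) Ql≡4a)) (trans (Q-neg μ) Qμ≡4b) ⟩
      a * (c * c * (+ 4 * a) + + 4 * b + + 2 * B (scale c l) (negOK μ)) ≡⟨ cong (λ x → a * (c * c * (+ 4 * a) + + 4 * b + + 2 * x)) B[c·l,-μ] ⟩
      a * (c * c * (+ 4 * a) + + 4 * b + + 2 * (c * - (+ 2 * T)))       ≡⟨ expand a b c T ⟩
      (+ 2 * a * c - T) * (+ 2 * a * c - T) - (T * T - + 4 * a * b)     ∎
      where
      open ≡-Reasoning
      expand : ∀ a b c T → a * (c * c * (+ 4 * a) + + 4 * b + + 2 * (c * - (+ 2 * T))) ≡
        (+ 2 * a * c - T) * (+ 2 * a * c - T) - (T * T - + 4 * a * b)
      expand = solve-∀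
      B[c·l,-μ] : B (scale c l) (negOK μ) ≡ c * - (+ 2 * T)
      B[c·l,-μ] = trans (B-scaleˡ c l (negOK μ)) (cong (c *_) (trans (B-sym l (negOK μ)) (trans (B-negˡ μ l) (cong -_ (trans (B-sym μ l) Blμ≡2T)))))

    -- a Q(c l - μ) = (2ac - T)² - Δ > 0, and B(c l - μ, l) = 2(2ac - T) > 0 rules out μ - c l ∈ O_K^+.
    totPos-c·l-μ : ∀ {Δ g c} → TotPos D l → T * T ≡ Δ + + 4 * a * b → 0ℤ < a → 0ℤ ≤ g → Δ < (g + + 1) * (g + + 1) →
      T + g < + 2 * a * c → TotPos D (subOK (scale c l) μ)
    totPos-c·l-μ {Δ} {g} {c} tl T²≡Δ+4ab 0<a 0≤g Δ<[g+1]² T+g<2ac = [ id , ⊥-elim ∘ ¬totPos-μ-c·l ]′ (0<Q⇒±totPos 0<Qν)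
      where
      0≤g+1 : 0ℤ ≤ g + + 1
      0≤g+1 = 0≤+ 0≤g (0≤n 1)
      g+1≤2ac-T : g + + 1 ≤ + 2 * a * c - T
      g+1≤2ac-T = ≤-by-difference (+ 2 * a * c - (+ 1 + (T + g))) (expand (+ 2 * a * c) T g) (ℤP.i≤j⇒0≤j-i (ℤP.i<j⇒suc[i]≤j T+g<2ac))
        where
        expand : ∀ x T g → x - T - (g + + 1) ≡ x - (+ 1 + (T + g))
        expand = solve-∀
      0<2ac-T : 0ℤ < + 2 * a * c - T
      0<2ac-T = ℤP.<-≤-trans (subst (0ℤ <_) (ℤP.+-comm (+ 1) g) (0<+ (0<1+n 0) 0≤g)) g+1≤2ac-T
      ¬totPos-μ-c·l : ¬ TotPos D (negOK (subOK (scale c l) μ))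
      ¬totPos-μ-c·l t = 0≤i⇒¬0<-i (ℤP.<⇒≤ (0<* (0<1+n 1) 0<2ac-T))
        (subst (0ℤ <_) (trans (B-negˡ (subOK (scale c l) μ) l) (cong -_ (B[c·l-μ,l] c))) (0<B t tl))
      T²-4ab≡Δ : T * T - + 4 * a * b ≡ Δ
      T²-4ab≡Δ = trans (cong (_- + 4 * a * b) T²≡Δ+4ab) (cancel Δ (+ 4 * a * b))
        where
        cancel : ∀ Δ y → Δ + y - y ≡ Δ
        cancel = solve-∀
      0<Qν : 0ℤ < Q (subOK (scale c l) μ)
      0<Qν = 0<*⇒0< 0<a (subst (0ℤ <_) (sym (trans (a·Q[c·l-μ] c) (cong (_-_ ((+ 2 * a * c - T) * (+ 2 * a * c - T))) T²-4ab≡Δ)))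
        (<⇒0<- (ℤP.<-≤-trans Δ<[g+1]² (*-mono-≤-nonNeg (ℤP.≤-trans 0≤g+1 g+1≤2ac-T) 0≤g+1 g+1≤2ac-T g+1≤2ac-T))))

module Representations (D : ℕ) where

  open import Data.Nat using (zero; suc)
  open import Defs using (OK; addOK; zeroOK; sumOK; Indecomposable; IsRep; AtMostRepsCount)
  import Data.Nat.Properties as ℕP
  open import Data.Integer using (+_; _+_; _*_)
  import Data.Integer as ℤ
  import Data.Integer.Properties as ℤP
  open import Data.Integer.Tactic.RingSolver using (solve-∀)
  open import Data.Fin using (Fin; toℕ)
  import Data.Fin.Properties as FinP
  open import Data.List using (List; []; _∷_; _++_; replicate; concat; length; filter)
  open import Data.List.Properties using (length-++; filter-++; filter-none; filter-accept)
  open import Data.List.Relation.Unary.All using (All; []; _∷_)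
  open import Data.List.Relation.Unary.All.Properties using (++⁺; concat⁺; replicate⁺)
  open import Data.List.Relation.Binary.Permutation.Propositional using (_↭_)
  open import Data.List.Relation.Binary.Permutation.Propositional.Properties using (↭-length; filter-↭)
  open import Data.Product using (Σ; ∃₂; _×_; _,_)
  open import Data.Product.Properties using (≡-dec)
  open import Relation.Nullary using (¬_; ¬?)
  open import Relation.Unary using (Decidable)
  open import Relation.Binary.PropositionalEquality
  open Lattice

  -- unlike IsRep, this allows the empty decomposition of zero
  Decomposition : OK → Set
  Decomposition β = Σ (List OK) λ L → All (Indecomposable D) L × sumOK L ≡ β

  decomposition-zero : Decomposition zeroOK
  decomposition-zero = [] , [] , refl

  decomposition-+ : ∀ {β γ} → Decomposition β → Decomposition γ → Decomposition (addOK β γ)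
  decomposition-+ (L , indec , ΣL≡β) (L' , indec' , ΣL'≡γ) =
    L ++ L' , ++⁺ indec indec' , trans (sumOK-++ L L') (cong₂ addOK ΣL≡β ΣL'≡γ)

  private
    differs? : ∀ x → Decidable (_≢ x)
    differs? x y = ¬? (≡-dec ℤ._≟_ ℤ._≟_ y x)

    others : OK → List OK → ℕ
    others x xs = length (filter (differs? x) xs)

    others-++ : ∀ x xs ys → others x (xs ++ ys) ≡ others x xs ℕ.+ others x ys
    others-++ x xs ys = trans (cong length (filter-++ (differs? x) xs ys)) (length-++ (filter (differs? x) xs))

    others-concat-replicate : ∀ x n xs → others x (concat (replicate n xs)) ≡ n ℕ.* others x xs
    others-concat-replicate x zero xs = refl
    others-concat-replicate x (suc n) xs =
      trans (others-++ x xs (concat (replicate n xs))) (cong (others x xs ℕ.+_) (others-concat-replicate x n xs))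

    others-replicate : ∀ x n → others x (replicate n x) ≡ 0
    others-replicate x n = cong length (filter-none (differs? x) (replicate⁺ n (λ ¬x≢x → ¬x≢x refl)))

    others-↭ : ∀ x {xs ys} → xs ↭ ys → others x xs ≡ others x ys
    others-↭ x xs↭ys = ↭-length (filter-↭ (differs? x) xs↭ys)

    others-cons : ∀ x {y} ys → y ≢ x → others x (y ∷ ys) ≡ suc (others x ys)
    others-cons x ys y≢x = cong length (filter-accept (differs? x) y≢x)

  -- For 0 ≤ i ≤ M, use i copies of μ + ν and M - i copies of c l: the number of summands
  -- different from l grows strictly with i, so these M + 1 representations are pairwise distinct.
  many-representations : ∀ M c {l μ ν ρ α} → Indecomposable D l → Indecomposable D μ → μ ≢ l →
    addOK μ ν ≡ scale (+ c) l → α ≡ addOK (scale (+ (M ℕ.* c)) l) ρ → α ≢ zeroOK →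
    Decomposition ν → Decomposition ρ → ¬ AtMostRepsCount D α M
  many-representations M c {l} {μ} {ν} {ρ} {α} indec-l indec-μ μ≢l μ+ν≡cl α≡ α≢0 (Lν , indec-ν , ΣLν≡ν) (Lρ , indec-ρ , ΣLρ≡ρ) atMost =
    pairwise-distinct (atMost reps is-rep)
    where
    reps : Fin (suc M) → List OK
    reps i = concat (replicate (toℕ i) (μ ∷ Lν)) ++ (concat (replicate (M ℕ.∸ toℕ i) (replicate c l)) ++ Lρ)

    split : ∀ i k u v → i ℕ.+ k ≡ M →
      addOK (scale (+ i) (scale (+ c) u)) (addOK (scale (+ k) (scale (+ c) u)) v) ≡ addOK (scale (+ (M ℕ.* c)) u) v
    split i k (x₁ , x₂) (r₁ , r₂) i+k≡M = cong₂ _,_ (coordinate x₁ r₁) (coordinate x₂ r₂)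
      where
      expand : ∀ i k c x r → i * (c * x) + (k * (c * x) + r) ≡ ((i + k) * c) * x + r
      expand = solve-∀
      Mc≡ : (+ i + + k) * + c ≡ + (M ℕ.* c)
      Mc≡ = trans (cong (λ n → + n * + c) i+k≡M) (sym (ℤP.pos-* M c))
      coordinate : ∀ x r → + i * (+ c * x) + (+ k * (+ c * x) + r) ≡ + (M ℕ.* c) * x + r
      coordinate x r = trans (expand (+ i) (+ k) (+ c) x r) (cong (λ z → z * x + r) Mc≡)

    sum-reps : ∀ i → sumOK (reps i) ≡ α
    sum-reps i = begin
      sumOK (reps i)
        ≡⟨ sumOK-++ (concat (replicate (toℕ i) (μ ∷ Lν))) _ ⟩
      addOK (sumOK (concat (replicate (toℕ i) (μ ∷ Lν)))) (sumOK (concat (replicate k (replicate c l)) ++ Lρ))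
        ≡⟨ cong₂ addOK (sumOK-concat-replicate (toℕ i) (μ ∷ Lν)) (sumOK-++ (concat (replicate k (replicate c l))) Lρ) ⟩
      addOK (scale (+ toℕ i) (addOK μ (sumOK Lν))) (addOK (sumOK (concat (replicate k (replicate c l)))) (sumOK Lρ))
        ≡⟨ cong₂ (λ x y → addOK (scale (+ toℕ i) x) y)
                 (trans (cong (addOK μ) ΣLν≡ν) μ+ν≡cl)
                 (cong₂ addOK (trans (sumOK-concat-replicate k (replicate c l)) (cong (scale (+ k)) (sumOK-replicate c l))) ΣLρ≡ρ) ⟩
      addOK (scale (+ toℕ i) (scale (+ c) l)) (addOK (scale (+ k) (scale (+ c) l)) ρ)
        ≡⟨ split (toℕ i) k l ρ (ℕP.m+[n∸m]≡n (ℕP.≤-pred (FinP.toℕ<n i))) ⟩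
      addOK (scale (+ (M ℕ.* c)) l) ρ
        ≡⟨ sym α≡ ⟩
      α ∎
      where
      open ≡-Reasoning
      k = M ℕ.∸ toℕ i

    is-rep : ∀ i → IsRep D α (reps i)
    is-rep i = (λ ri≡[] → α≢0 (trans (sym (sum-reps i)) (cong sumOK ri≡[])))
             , ++⁺ (concat⁺ (replicate⁺ (toℕ i) (indec-μ ∷ indec-ν))) (++⁺ (concat⁺ (replicate⁺ (M ℕ.∸ toℕ i) (replicate⁺ c indec-l))) indec-ρ)
             , sum-reps i

    others-reps : ∀ i → others l (reps i) ≡ toℕ i ℕ.* suc (others l Lν) ℕ.+ others l Lρ
    others-reps i = begin
      others l (reps i)
        ≡⟨ others-++ l (concat (replicate (toℕ i) (μ ∷ Lν))) _ ⟩
      others l (concat (replicate (toℕ i) (μ ∷ Lν))) ℕ.+ others l (concat (replicate k (replicate c l)) ++ Lρ)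
        ≡⟨ cong₂ ℕ._+_ (others-concat-replicate l (toℕ i) (μ ∷ Lν)) (others-++ l (concat (replicate k (replicate c l))) Lρ) ⟩
      toℕ i ℕ.* others l (μ ∷ Lν) ℕ.+ (others l (concat (replicate k (replicate c l))) ℕ.+ others l Lρ)
        ≡⟨ cong₂ (λ x y → toℕ i ℕ.* x ℕ.+ (y ℕ.+ others l Lρ))
                 (others-cons l Lν μ≢l)
                 (trans (others-concat-replicate l k (replicate c l)) (trans (cong (k ℕ.*_) (others-replicate l c)) (ℕP.*-zeroʳ k))) ⟩
      toℕ i ℕ.* suc (others l Lν) ℕ.+ others l Lρ ∎
      where
      open ≡-Reasoning
      k = M ℕ.∸ toℕ i

    pairwise-distinct : ¬ (∃₂ λ i j → i ≢ j × reps i ↭ reps j)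
    pairwise-distinct (i , j , i≢j , ri↭rj) = i≢j (FinP.toℕ-injective (ℕP.*-cancelʳ-≡ (toℕ i) (toℕ j) (suc (others l Lν))
      (ℕP.+-cancelʳ-≡ _ _ _ (trans (sym (others-reps i)) (trans (others-↭ l ri↭rj) (others-reps j))))))

module Indecomposables (D : ℕ) (2≤D : 2 ℕ.≤ D) where

  open import Defs using (addOK; TotPos; Indecomposable)
  open import Data.Nat.Induction using (<-wellFounded)
  open import Induction.WellFounded using (Acc; acc)
  open import Data.Integer using (0ℤ; -_; _<_; ∣_∣)
  import Data.Integer.Properties as ℤP
  open import Data.Empty using (⊥-elim)
  open import Data.Sum using (inj₁; inj₂)
  open import Data.Product using (_,_; proj₁)
  open import Data.List using (_∷_; [])
  open import Data.List.Relation.Unary.All using (_∷_; [])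
  open import Relation.Nullary using (¬_)
  open import Relation.Binary.PropositionalEquality
  open IntegerInequalities
  open Lattice
  open Coordinates D
  open TotalPositivity D 2≤D
  open Representations D

  -- det(-, w) is additive and has a constant strict sign on totally positive elements.
  private
    indecomposable-by-positive-det : ∀ {w x} → 0ℤ < - Q w → 0ℤ < Y w → TotPos D x → ∣ det x w ∣ ≡ 1 → Indecomposable D x
    indecomposable-by-positive-det {w} 0<-Qw 0<Yw tx ∣det∣≡1 = tx , λ (β , γ , tβ , tγ , x≡β+γ) →
      ∣i+j∣≢1 (0<det tβ 0<-Qw 0<Yw) (0<det tγ 0<-Qw 0<Yw)
        (trans (cong ∣_∣ (sym (trans (cong (λ z → det z w) x≡β+γ) (det-+ˡ β γ w)))) ∣det∣≡1)

  indecomposable-by-det : ∀ {w x} → 0ℤ < - Q w → TotPos D x → ∣ det x w ∣ ≡ 1 → Indecomposable D x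
  indecomposable-by-det {w} {x} 0<-Qw tx ∣det∣≡1 with sign-trichotomy (Y w)
  ... | inj₁ 0<Yw = indecomposable-by-positive-det 0<-Qw 0<Yw tx ∣det∣≡1
  ... | inj₂ (inj₁ Yw≡0) = ⊥-elim (Y≡0⇒¬0<-Q Yw≡0 0<-Qw)
  ... | inj₂ (inj₂ 0<-Yw) = indecomposable-by-positive-det
    (subst (λ q → 0ℤ < - q) (sym (Q-neg w)) 0<-Qw) (subst (0ℤ <_) (sym (Y-neg w)) 0<-Yw) tx
    (trans (cong ∣_∣ (det-negʳ x w)) (trans (ℤP.∣-i∣≡∣i∣ (det x w)) ∣det∣≡1))

  -- Constructively: if β had no decomposition, every splitting β = γ + δ would produce one
  -- (by induction on X), so β would be indecomposable and [β] a decomposition after all.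
  ¬¬decomposition : ∀ {β} → TotPos D β → ¬ ¬ Decomposition β
  ¬¬decomposition {β} = go β (<-wellFounded ∣ X β ∣)
    where
    go : ∀ β → Acc ℕ._<_ ∣ X β ∣ → TotPos D β → ¬ ¬ Decomposition β
    go β (acc smaller) tβ ¬decomposition = ¬decomposition ((β ∷ []) , (indecomposable ∷ []) , addOK-identityʳ β)
      where
      shrinks : ∀ {γ δ} → TotPos D γ → TotPos D δ → β ≡ addOK γ δ → ∣ X γ ∣ ℕ.< ∣ X β ∣
      shrinks {γ} {δ} tγ tδ β≡γ+δ = ∣i∣<∣j∣ (ℤP.<⇒≤ (proj₁ tγ)) (subst (λ z → X γ < X z) (sym β≡γ+δ) (X<X-+ γ tδ))
      indecomposable : Indecomposable D β
      indecomposable = tβ , λ (γ , δ , tγ , tδ , β≡γ+δ) →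
        go γ (smaller (shrinks tγ tδ β≡γ+δ)) tγ λ dγ →
        go δ (smaller (shrinks tδ tγ (trans β≡γ+δ (addOK-comm γ δ)))) tδ λ dδ →
        ¬decomposition (subst Decomposition (sym β≡γ+δ) (decomposition-+ dγ dδ))

module ConeReduction (D : ℕ) (2≤D : 2 ℕ.≤ D) where

  open import Data.Nat using (zero; suc)
  open import Defs using (OK; addOK; TotPos)
  import Data.Nat.Properties as ℕP
  open import Data.Nat.Induction using (<-wellFounded)
  open import Induction.WellFounded using (Acc; acc)
  open import Data.Integer using (+_; 0ℤ; 1ℤ; _+_; _*_; _-_; -_; _<_; _≤_; ∣_∣)
  import Data.Integer.Properties as ℤP
  open import Data.Integer.Tactic.RingSolver using (solve-∀)
  open import Data.Empty using (⊥-elim)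
  open import Data.Sum using (_⊎_; inj₁; inj₂)
  open import Data.Product using (Σ; _×_; _,_; proj₁; proj₂)
  open import Relation.Nullary using (¬_; Dec; yes; no)
  open import Relation.Binary.PropositionalEquality
  open IntegerInequalities
  open Lattice
  open Coordinates D
  open TotalPositivity D 2≤D

  InCone : OK → OK → OK → Set
  InCone α l μ = 0ℤ ≤ det l α × 0ℤ ≤ det α μ

  record PositiveCone (α : OK) (K : ℕ) : Set where
    field
      l μ : OK
      totPos-l : TotPos D l
      totPos-μ : TotPos D μ
      det≡K : det l μ ≡ + K
      α∈cone : InCone α l μ

  private
    cone : ∀ {α} l μ → TotPos D l → TotPos D μ → 0ℤ < det l μ → InCone α l μ → Σ ℕ λ K → PositiveCone α (suc K)
    cone l μ tl tμ 0<det α∈cone with 0<i⇒i≡1+n 0<det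
    ... | K , det≡1+K = K , record { l = l ; μ = μ ; totPos-l = tl ; totPos-μ = tμ ; det≡K = det≡1+K ; α∈cone = α∈cone }

  record ReducedBasis (α : OK) : Set where
    field
      l μ : OK
      totPos-l : TotPos D l
      totPos-μ : TotPos D μ
      det≡1 : det l μ ≡ 1ℤ
      α∈cone : InCone α l μ
      ¬totPos-l-μ : ¬ TotPos D (subOK l μ)
      ¬totPos-μ-l : ¬ TotPos D (subOK μ l)

  initial-cone : ∀ {α} → TotPos D α → Σ ℕ λ K → PositiveCone α (suc K)
  initial-cone {α@(a , b)} tα with sign-trichotomy b
  ... | inj₁ 0<b = cone (1ℤ , 0ℤ) α totPos-1 tα (subst (0ℤ <_) (sym det-1-α) 0<b) (subst (0ℤ ≤_) (sym det-1-α) (ℤP.<⇒≤ 0<b) , ℤP.≤-reflexive (sym (det-self α)))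
    where
    expand : ∀ a b → 1ℤ * b - 0ℤ * a ≡ b
    expand = solve-∀
    det-1-α : det (1ℤ , 0ℤ) α ≡ b
    det-1-α = expand a b
  ... | inj₂ (inj₂ 0<-b) = cone α (1ℤ , 0ℤ) tα totPos-1 (subst (0ℤ <_) (sym det-α-1) 0<-b) (ℤP.≤-reflexive (sym (det-self α)) , subst (0ℤ ≤_) (sym det-α-1) (ℤP.<⇒≤ 0<-b))
    where
    expand : ∀ a b → a * 0ℤ - b * 1ℤ ≡ - b
    expand = solve-∀
    det-α-1 : det α (1ℤ , 0ℤ) ≡ - b
    det-α-1 = expand a b
  ... | inj₂ (inj₁ refl) = cone α (+ D , 1ℤ) tα totPos-D+ω (subst (0ℤ <_) (sym det-α-[D+ω]) 0<a) (ℤP.≤-reflexive (sym (det-self α)) , subst (0ℤ ≤_) (sym det-α-[D+ω]) (ℤP.<⇒≤ 0<a))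
    where
    expand₁ : ∀ a d → a * 1ℤ - 0ℤ * d ≡ a
    expand₁ = solve-∀
    det-α-[D+ω] : det α (+ D , 1ℤ) ≡ a
    det-α-[D+ω] = expand₁ a (+ D)
    expand₂ : ∀ a ξ → + 2 * a + ξ * 0ℤ ≡ + 2 * a
    expand₂ = solve-∀
    0<a : 0ℤ < a
    0<a = 0<*⇒0< (0<1+n 1) (subst (0ℤ <_) (trans (X-form a 0ℤ) (expand₂ a ξ)) (proj₁ tα))

  private
    choose-side : ∀ s t {K x y w w'} → 0ℤ < K → 0ℤ ≤ x → 0ℤ ≤ y → ¬ (s ≡ 0 × t ≡ 0) →
      K * w ≡ + s * x - + t * y → w' ≡ - w →
      (Σ ℕ λ t' → t ≡ suc t' × 0ℤ ≤ w') ⊎ (Σ ℕ λ s' → s ≡ suc s' × 0ℤ ≤ w)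
    choose-side zero zero _ _ _ nonzero _ _ = ⊥-elim (nonzero (refl , refl))
    choose-side zero (suc t) {K} {x} {y} {w} 0<K _ 0≤y _ Kw≡ refl = inj₁ (t , refl , 0≤*⇒0≤ 0<K (subst (0ℤ ≤_) (sym Kw'≡) (0≤* (0≤n (suc t)) 0≤y)))
      where
      expand : ∀ K w x y → K * w ≡ 0ℤ * x - y → K * - w ≡ y
      expand K w x y eq = trans (sym (ℤP.neg-distribʳ-* K w)) (trans (cong -_ eq) (solve-∀' x y))
        where
        solve-∀' : ∀ x y → - (0ℤ * x - y) ≡ y
        solve-∀' = solve-∀
      Kw'≡ : K * - w ≡ + suc t * y
      Kw'≡ = expand K w x (+ suc t * y) Kw≡
    choose-side (suc s) zero {K} {x} {y} {w} 0<K 0≤x _ _ Kw≡ _ = inj₂ (s , refl , 0≤*⇒0≤ 0<K (subst (0ℤ ≤_) (sym Kw≡′) (0≤* (0≤n (suc s)) 0≤x)))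
      where
      Kw≡′ : K * w ≡ + suc s * x
      Kw≡′ = trans Kw≡ (ℤP.+-identityʳ (+ suc s * x))
    choose-side (suc s) (suc t) {w = w} _ _ _ _ _ w'≡-w with sign-trichotomy w
    ... | inj₁ 0<w = inj₂ (s , refl , ℤP.<⇒≤ 0<w)
    ... | inj₂ (inj₁ w≡0) = inj₂ (s , refl , ℤP.≤-reflexive (sym w≡0))
    ... | inj₂ (inj₂ 0<-w) = inj₁ (t , refl , subst (0ℤ ≤_) (sym w'≡-w) (ℤP.<⇒≤ 0<-w))

  -- A nonzero point p of the fundamental parallelogram is totally positive and splits
  -- the cone into two cones of smaller determinant, one of which contains α.
  refine-cone : ∀ {α k} → PositiveCone α (suc (suc k)) → Σ ℕ λ K → K ℕ.< suc k × PositiveCone α (suc K)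
  refine-cone {α} {k} record { l = l ; μ = μ ; totPos-l = tl ; totPos-μ = tμ ; det≡K = det≡K ; α∈cone = (0≤det-l-α , 0≤det-α-μ) }
    = refine sub-cone
    where
    K = suc (suc k)
    open ParallelogramPoint (parallelogram-point {l = l} {μ = μ} det≡K (ℕ.s≤s (ℕ.s≤s ℕ.z≤n)))
    totPos-p : TotPos D p
    totPos-p with totPos-combination s t tl tμ
    ... | inj₁ t-s·l+t·μ = totPos-scale⁻¹ (suc k) (subst (TotPos D) (sym K·p≡s·l+t·μ) t-s·l+t·μ)
    ... | inj₂ s≡0×t≡0 = ⊥-elim (nonzero s≡0×t≡0)
    K·det-l-p : + K * det l p ≡ + K * + t
    K·det-l-p = begin
      + K * det l p                                   ≡⟨ sym (det-scaleʳ (+ K) l p) ⟩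
      det l (scale (+ K) p)                           ≡⟨ cong (det l) K·p≡s·l+t·μ ⟩
      det l (addOK (scale (+ s) l) (scale (+ t) μ))   ≡⟨ det-linearʳ l (+ s) l (+ t) μ ⟩
      + s * det l l + + t * det l μ                   ≡⟨ cong₂ (λ x y → + s * x + + t * y) (det-self l) det≡K ⟩
      + s * 0ℤ + + t * + K                            ≡⟨ expand (+ s) (+ t) (+ K) ⟩
      + K * + t                                       ∎
      where
      open ≡-Reasoning
      expand : ∀ s t K → s * 0ℤ + t * K ≡ K * t
      expand = solve-∀
    K·det-p-μ : + K * det p μ ≡ + K * + s
    K·det-p-μ = begin
      + K * det p μ                                   ≡⟨ sym (det-scaleˡ (+ K) p μ) ⟩
      det (scale (+ K) p) μ                           ≡⟨ cong (λ z → det z μ) K·p≡s·l+t·μ ⟩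
      det (addOK (scale (+ s) l) (scale (+ t) μ)) μ   ≡⟨ det-linearˡ μ (+ s) l (+ t) μ ⟩
      + s * det l μ + + t * det μ μ                   ≡⟨ cong₂ (λ x y → + s * x + + t * y) det≡K (det-self μ) ⟩
      + s * + K + + t * 0ℤ                            ≡⟨ expand (+ s) (+ t) (+ K) ⟩
      + K * + s                                       ∎
      where
      open ≡-Reasoning
      expand : ∀ s t K → s * K + t * 0ℤ ≡ K * s
      expand = solve-∀
    K·det-p-α : + K * det p α ≡ + s * det l α - + t * det α μ
    K·det-p-α = begin
      + K * det p α                                   ≡⟨ sym (det-scaleˡ (+ K) p α) ⟩
      det (scale (+ K) p) α                           ≡⟨ cong (λ z → det z α) K·p≡s·l+t·μ ⟩
      det (addOK (scale (+ s) l) (scale (+ t) μ)) α   ≡⟨ det-linearˡ α (+ s) l (+ t) μ ⟩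
      + s * det l α + + t * det μ α                   ≡⟨ cong (λ x → + s * det l α + + t * x) (det-antisym μ α) ⟩
      + s * det l α + + t * - det α μ                 ≡⟨ expand (+ s) (+ t) (det l α) (det α μ) ⟩
      + s * det l α - + t * det α μ                   ∎
      where
      open ≡-Reasoning
      expand : ∀ s t x y → s * x + t * - y ≡ s * x - t * y
      expand = solve-∀
    sub-cone : (Σ ℕ λ t' → t ≡ suc t' × 0ℤ ≤ det α p) ⊎ (Σ ℕ λ s' → s ≡ suc s' × 0ℤ ≤ det p α)
    sub-cone = choose-side s t (0<1+n (suc k)) 0≤det-l-α 0≤det-α-μ nonzero K·det-p-α (det-antisym α p)
    refine : (Σ ℕ λ t' → t ≡ suc t' × 0ℤ ≤ det α p) ⊎ (Σ ℕ λ s' → s ≡ suc s' × 0ℤ ≤ det p α) →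
      Σ ℕ λ K' → K' ℕ.< suc k × PositiveCone α (suc K')
    refine (inj₁ (t' , t≡1+t' , 0≤det-α-p)) = t' , ℕP.≤-pred (subst (ℕ._< K) t≡1+t' t<K) , record
      { l = l ; μ = p ; totPos-l = tl ; totPos-μ = totPos-p
      ; det≡K = trans (ℤP.*-cancelˡ-≡ (+ K) _ _ K·det-l-p) (cong +_ t≡1+t') ; α∈cone = 0≤det-l-α , 0≤det-α-p }
    refine (inj₂ (s' , s≡1+s' , 0≤det-p-α)) = s' , ℕP.≤-pred (subst (ℕ._< K) s≡1+s' s<K) , record
      { l = p ; μ = μ ; totPos-l = totPos-p ; totPos-μ = tμ
      ; det≡K = trans (ℤP.*-cancelˡ-≡ (+ K) _ _ K·det-p-μ) (cong +_ s≡1+s') ; α∈cone = 0≤det-p-α , 0≤det-α-μ }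

  unimodular-cone : ∀ {α K} → PositiveCone α (suc K) → PositiveCone α 1
  unimodular-cone {α} {K} = descend K (<-wellFounded K)
    where
    descend : ∀ K → Acc ℕ._<_ K → PositiveCone α (suc K) → PositiveCone α 1
    descend zero _ cone₁ = cone₁
    descend (suc k) (acc smaller) cone =
      let K' , K'<1+k , cone' = refine-cone cone in descend K' (smaller K'<1+k) cone'

  private
    reduce-trace : ∀ {α} l μ → Acc ℕ._<_ (∣ X l ∣ ℕ.+ ∣ X μ ∣) → TotPos D l → TotPos D μ → det l μ ≡ 1ℤ →
      InCone α l μ → ReducedBasis α
    reduce-trace {α} l μ (acc smaller) tl tμ det≡1 (0≤det-l-α , 0≤det-α-μ) = step (totPos? (subOK l μ)) (totPos? (subOK μ l))
      where
      step : Dec (TotPos D (subOK l μ)) → Dec (TotPos D (subOK μ l)) → ReducedBasis α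
      step (yes tl-μ) _ = reduce-trace (subOK l μ) μ
        (smaller (ℕP.+-monoˡ-< ∣ X μ ∣ (∣i∣<∣j∣ (ℤP.<⇒≤ (proj₁ tl-μ)) (X-subOK<X l tμ)))) tl-μ tμ
        (trans (det-subOKˡ l μ μ) (cong₂ _+_ det≡1 (det-self μ)))
        (subst (0ℤ ≤_) (sym (det-subOKˡ l μ α)) (0≤+ 0≤det-l-α 0≤det-α-μ) , 0≤det-α-μ)
      step (no _) (yes tμ-l) = reduce-trace l (subOK μ l)
        (smaller (ℕP.+-monoʳ-< ∣ X l ∣ (∣i∣<∣j∣ (ℤP.<⇒≤ (proj₁ tμ-l)) (X-subOK<X μ tl)))) tl tμ-l
        (trans (det-subOKʳ l μ l) (cong₂ _+_ det≡1 (det-self l)))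
        (0≤det-l-α , subst (0ℤ ≤_) (sym (det-subOKʳ α μ l)) (0≤+ 0≤det-α-μ 0≤det-l-α))
      step (no ¬tl-μ) (no ¬tμ-l) = record
        { l = l ; μ = μ ; totPos-l = tl ; totPos-μ = tμ ; det≡1 = det≡1 ; α∈cone = 0≤det-l-α , 0≤det-α-μ
        ; ¬totPos-l-μ = ¬tl-μ ; ¬totPos-μ-l = ¬tμ-l }

  reduced-basis : ∀ {α} → TotPos D α → ReducedBasis α
  reduced-basis tα = reduce-trace l μ (<-wellFounded _) totPos-l totPos-μ det≡K α∈cone
    where open PositiveCone (unimodular-cone (proj₂ (initial-cone tα)))

module NormBound (D : ℕ) (2≤D : 2 ℕ.≤ D) (sf : SquareFree D) where

  open import Data.Nat using (suc)
  open import Defs using (OK; addOK; zeroOK; TotPos; Indecomposable; AtMostRepsCount; norm; disc; _<_·√_)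
  import Data.Nat.Properties as ℕP
  open import Data.Integer using (ℤ; +_; 0ℤ; 1ℤ; _+_; _*_; _-_; -_; _<_; _≤_; ∣_∣; +≤+; +<+)
  import Data.Integer as ℤ
  import Data.Integer.Properties as ℤP
  open import Data.Integer.Tactic.RingSolver using (solve-∀)
  open import Data.Empty using (⊥-elim)
  open import Data.Sum using (inj₁; inj₂; [_,_]′)
  open import Data.Product using (_,_; proj₁; proj₂)
  open import Relation.Nullary using (¬_; yes; no)
  open import Relation.Binary.PropositionalEquality
  open import Function using (_∘_)
  open IntegerInequalities
  open NonSquare
  open FormBound
  open Lattice
  open Coordinates D
  open TotalPositivity D 2≤D
  open Representations D
  open Indecomposables D 2≤D
  open ConeReduction D 2≤D

  Q≡0⇒≡0 : ∀ w → Q w ≡ 0ℤ → w ≡ zeroOK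
  Q≡0⇒≡0 w Q≡0 with Y w ℤ.≟ 0ℤ
  ... | yes Y≡0 = XY-injective w (i*i≡0⇒i≡0 X²≡0) Y≡0
    where
    expand : ∀ x d → x * x - d * 0ℤ * 0ℤ ≡ x * x
    expand = solve-∀
    X²≡0 : X w * X w ≡ 0ℤ
    X²≡0 = trans (sym (expand (X w) (+ D))) (trans (cong (λ y → X w * X w - + D * y * y) (sym Y≡0)) Q≡0)
  ... | no Y≢0 = ⊥-elim (squareFree⇒D*y²≢x² D 2≤D sf ∣ X w ∣ ∣ Y w ∣ (ℕP.n≢0⇒n>0 (Y≢0 ∘ ℤP.∣i∣≡0⇒i≡0)) D∣Y∣²≡∣X∣²)
    where
    DY²≡X² : + D * (Y w * Y w) ≡ X w * X w
    DY²≡X² = trans (sym (ℤP.*-assoc (+ D) (Y w) (Y w))) (sym (ℤP.i-j≡0⇒i≡j _ _ Q≡0))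
    D∣Y∣²≡∣X∣² : D ℕ.* (∣ Y w ∣ ℕ.* ∣ Y w ∣) ≡ ∣ X w ∣ ℕ.* ∣ X w ∣
    D∣Y∣²≡∣X∣² = begin
      D ℕ.* (∣ Y w ∣ ℕ.* ∣ Y w ∣)  ≡⟨ cong (D ℕ.*_) (sym (ℤP.abs-* (Y w) (Y w))) ⟩
      D ℕ.* ∣ Y w * Y w ∣          ≡⟨ sym (ℤP.abs-* (+ D) (Y w * Y w)) ⟩
      ∣ + D * (Y w * Y w) ∣        ≡⟨ cong ∣_∣ DY²≡X² ⟩
      ∣ X w * X w ∣                ≡⟨ ℤP.abs-* (X w) (X w) ⟩
      ∣ X w ∣ ℕ.* ∣ X w ∣          ∎
      where open ≡-Reasoning

  ¬±totPos⇒0<-Q : ∀ w → w ≢ zeroOK → ¬ TotPos D w → ¬ TotPos D (negOK w) → 0ℤ < - Q w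
  ¬±totPos⇒0<-Q w w≢0 ¬tw ¬t-w with sign-trichotomy (Q w)
  ... | inj₁ 0<Q = ⊥-elim ([ ¬tw , ¬t-w ]′ (0<Q⇒±totPos 0<Q))
  ... | inj₂ (inj₁ Q≡0) = ⊥-elim (w≢0 (Q≡0⇒≡0 w Q≡0))
  ... | inj₂ (inj₂ 0<-Q) = 0<-Q

  module BasisFacts {α : OK} (basis : ReducedBasis α) where
    open ReducedBasis basis public

    private
      w = subOK μ l
      det-l-w : det l w ≡ 1ℤ
      det-l-w = trans (det-subOKʳ l μ l) (cong₂ _+_ det≡1 (det-self l))
      det-μ-w : det μ w ≡ 1ℤ
      det-μ-w = trans (det-subOKʳ μ μ l) (cong₂ _+_ (det-self μ) det≡1)
      w≢0 : w ≢ zeroOK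
      w≢0 w≡0 with trans (sym det-l-w) (trans (cong (det l) w≡0) (det-zeroʳ l))
      ... | ()
      0<-Qw : 0ℤ < - Q w
      0<-Qw = ¬±totPos⇒0<-Q w w≢0 ¬totPos-μ-l (¬totPos-l-μ ∘ subst (TotPos D) (negOK-subOK μ l))

    indecomposable-l : Indecomposable D l
    indecomposable-l = indecomposable-by-det 0<-Qw totPos-l (cong ∣_∣ det-l-w)

    indecomposable-μ : Indecomposable D μ
    indecomposable-μ = indecomposable-by-det 0<-Qw totPos-μ (cong ∣_∣ det-μ-w)

    μ≢l : μ ≢ l
    μ≢l μ≡l with trans (sym det≡1) (trans (cong (det l) μ≡l) (det-self l))
    ... | ()

    a b T : ℤ
    a = norm D l
    b = norm D μ
    T = norm D (addOK l μ) - a - b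

    Ql≡4a : Q l ≡ + 4 * a
    Ql≡4a = Q≡4·norm l

    Qμ≡4b : Q μ ≡ + 4 * b
    Qμ≡4b = Q≡4·norm μ

    Blμ≡2T : B l μ ≡ + 2 * T
    Blμ≡2T = ℤP.*-cancelˡ-≡ (+ 2) _ _ (begin
      + 2 * B l μ                                          ≡⟨ isolate (Q l) (Q μ) (B l μ) ⟩
      Q l + Q μ + + 2 * B l μ - Q l - Q μ                  ≡⟨ cong₂ (λ x y → x - y - Q μ) (sym (Q-+ l μ)) Ql≡4a ⟩
      Q (addOK l μ) - + 4 * a - Q μ                        ≡⟨ cong₂ (λ x y → x - + 4 * a - y) (Q≡4·norm (addOK l μ)) Qμ≡4b ⟩
      + 4 * norm D (addOK l μ) - + 4 * a - + 4 * b         ≡⟨ factor (norm D (addOK l μ)) a b ⟩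
      + 2 * (+ 2 * T)                                      ∎)
      where
      open ≡-Reasoning
      isolate : ∀ p q r → + 2 * r ≡ p + q + + 2 * r - p - q
      isolate = solve-∀
      factor : ∀ n a b → + 4 * n - + 4 * a - + 4 * b ≡ + 2 * (+ 2 * (n - a - b))
      factor = solve-∀

    0<a : 0ℤ < a
    0<a = 0<*⇒0< (0<1+n 3) (subst (0ℤ <_) Ql≡4a (0<Q totPos-l))

    0<b : 0ℤ < b
    0<b = 0<*⇒0< (0<1+n 3) (subst (0ℤ <_) Qμ≡4b (0<Q totPos-μ))

    0<T-a-b : 0ℤ < T - a - b
    0<T-a-b = 0<*⇒0< (0<1+n 3) (subst (0ℤ <_) -Qw≡ 0<-Qw)
      where
      expand : ∀ a b T → - (+ 4 * b + + 4 * a + + 2 * - (+ 2 * T)) ≡ + 4 * (T - a - b)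
      expand = solve-∀
      -Qw≡ : - Q w ≡ + 4 * (T - a - b)
      -Qw≡ = begin
        - Q w                                           ≡⟨ cong -_ (Q-+ μ (negOK l)) ⟩
        - (Q μ + Q (negOK l) + + 2 * B μ (negOK l))     ≡⟨ cong₂ (λ x y → - (Q μ + x + + 2 * y)) (Q-neg l) (trans (B-sym μ (negOK l)) (B-negˡ l μ)) ⟩
        - (Q μ + Q l + + 2 * - B l μ)                   ≡⟨ cong (λ x → - (x + Q l + + 2 * - B l μ)) Qμ≡4b ⟩
        - (+ 4 * b + Q l + + 2 * - B l μ)               ≡⟨ cong₂ (λ x y → - (+ 4 * b + x + + 2 * - y)) Ql≡4a Blμ≡2T ⟩
        - (+ 4 * b + + 4 * a + + 2 * - (+ 2 * T))       ≡⟨ expand a b T ⟩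
        + 4 * (T - a - b)                               ∎
        where open ≡-Reasoning

    T²≡Δ+4ab : T * T ≡ + disc D + + 4 * a * b
    T²≡Δ+4ab = ℤP.*-cancelˡ-≡ (+ 4) _ _ (begin
      + 4 * (T * T)                                                  ≡⟨ expand₁ T a b ⟩
      (+ 2 * T) * (+ 2 * T) - (+ 4 * a) * (+ 4 * b) + + 4 * (+ 4 * a * b)
                                                                     ≡⟨ cong₂ (λ x y → x - y + + 4 * (+ 4 * a * b)) (cong₂ _*_ (sym Blμ≡2T) (sym Blμ≡2T)) (cong₂ _*_ (sym Ql≡4a) (sym Qμ≡4b)) ⟩
      B l μ * B l μ - Q l * Q μ + + 4 * (+ 4 * a * b)                ≡⟨ cong (_+ + 4 * (+ 4 * a * b)) (lagrange l μ) ⟩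
      + D * ((X l * Y μ - X μ * Y l) * (X l * Y μ - X μ * Y l)) + + 4 * (+ 4 * a * b)
                                                                     ≡⟨ cong (λ x → + D * (x * x) + + 4 * (+ 4 * a * b)) (trans (XY-det l μ) (cong (+ 2 * η *_) det≡1)) ⟩
      + D * ((+ 2 * η * 1ℤ) * (+ 2 * η * 1ℤ)) + + 4 * (+ 4 * a * b) ≡⟨ expand₂ (+ D) η (+ 4 * a * b) ⟩
      + 4 * (+ D * η * η) + + 4 * (+ 4 * a * b)                      ≡⟨ cong (λ x → + 4 * x + + 4 * (+ 4 * a * b)) (sym disc≡Dη²) ⟩
      + 4 * + disc D + + 4 * (+ 4 * a * b)                           ≡⟨ sym (ℤP.*-distribˡ-+ (+ 4) (+ disc D) (+ 4 * a * b)) ⟩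
      + 4 * (+ disc D + + 4 * a * b)                                 ∎)
      where
      open ≡-Reasoning
      expand₁ : ∀ T a b → + 4 * (T * T) ≡ (+ 2 * T) * (+ 2 * T) - (+ 4 * a) * (+ 4 * b) + + 4 * (+ 4 * a * b)
      expand₁ = solve-∀
      expand₂ : ∀ d η x → d * ((+ 2 * η * 1ℤ) * (+ 2 * η * 1ℤ)) + + 4 * x ≡ + 4 * (d * η * η) + + 4 * x
      expand₂ = solve-∀

    s t : ℕ
    s = ∣ det α μ ∣
    t = ∣ det l α ∣

    α≡s·l+t·μ : α ≡ addOK (scale (+ s) l) (scale (+ t) μ)
    α≡s·l+t·μ = trans (cramer α l μ det≡1)
      (cong₂ (λ x y → addOK (scale x l) (scale y μ)) (sym (ℤP.0≤i⇒+∣i∣≡i (proj₂ α∈cone))) (sym (ℤP.0≤i⇒+∣i∣≡i (proj₁ α∈cone))))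

    norm-combination : ∀ s t → norm D (addOK (scale s l) (scale t μ)) ≡ form a T b s t
    norm-combination s t = ℤP.*-cancelˡ-≡ (+ 4) _ _ (begin
      + 4 * norm D (addOK (scale s l) (scale t μ))               ≡⟨ sym (Q≡4·norm (addOK (scale s l) (scale t μ))) ⟩
      Q (addOK (scale s l) (scale t μ))                          ≡⟨ Q-+ (scale s l) (scale t μ) ⟩
      Q (scale s l) + Q (scale t μ) + + 2 * B (scale s l) (scale t μ)
                                                                 ≡⟨ cong₂ (λ x y → x + y + + 2 * B (scale s l) (scale t μ)) (trans (Q-scale s l) (cong (s * s *_) Ql≡4a)) (trans (Q-scale t μ) (cong (t * t *_) Qμ≡4b)) ⟩
      s * s * (+ 4 * a) + t * t * (+ 4 * b) + + 2 * B (scale s l) (scale t μ)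
                                                                 ≡⟨ cong (λ x → s * s * (+ 4 * a) + t * t * (+ 4 * b) + + 2 * x) B-scale ⟩
      s * s * (+ 4 * a) + t * t * (+ 4 * b) + + 2 * (s * (t * (+ 2 * T))) ≡⟨ expand s t a b T ⟩
      + 4 * form a T b s t                                       ∎)
      where
      open ≡-Reasoning
      expand : ∀ s t a b T → s * s * (+ 4 * a) + t * t * (+ 4 * b) + + 2 * (s * (t * (+ 2 * T))) ≡ + 4 * (s * s * a + s * t * T + t * t * b)
      expand = solve-∀
      B-scale : B (scale s l) (scale t μ) ≡ s * (t * (+ 2 * T))
      B-scale = trans (B-scaleˡ s l (scale t μ)) (cong (s *_) (trans (B-sym l (scale t μ)) (trans (B-scaleˡ t μ l) (cong (t *_) (trans (B-sym μ l) Blμ≡2T)))))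

  private
    ¬¬decomposition-combination : ∀ s t {l μ} → TotPos D l → TotPos D μ → ¬ ¬ Decomposition (addOK (scale (+ s) l) (scale (+ t) μ))
    ¬¬decomposition-combination s t tl tμ with totPos-combination s t tl tμ
    ... | inj₁ tρ = ¬¬decomposition tρ
    ... | inj₂ (refl , refl) = λ ¬decomposition → ¬decomposition decomposition-zero

  -- α = (M c) l + ρ with ρ = (s - M c) l + t μ, and c l = μ + (c l - μ)
  coefficient-bound : ∀ M c s t {l μ α} → Indecomposable D l → Indecomposable D μ → μ ≢ l →
    TotPos D (subOK (scale (+ c) l) μ) → α ≡ addOK (scale (+ s) l) (scale (+ t) μ) → TotPos D α →
    AtMostRepsCount D α M → s ℕ.< M ℕ.* c
  coefficient-bound M c s t {l} {μ} {α} indec-l indec-μ μ≢l tν α≡ tα atMost with M ℕ.* c ℕP.≤? s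
  ... | no Mc≰s = ℕP.≰⇒> Mc≰s
  ... | yes Mc≤s = ⊥-elim (¬¬decomposition tν λ dν → ¬¬decomposition-combination (s ℕ.∸ M ℕ.* c) t (proj₁ indec-l) (proj₁ indec-μ) λ dρ →
          many-representations M c indec-l indec-μ μ≢l (addOK-subOK (scale (+ c) l) μ) α≡Mc·l+ρ (totPos⇒≢0 tα) dν dρ atMost)
    where
    α≡Mc·l+ρ : α ≡ addOK (scale (+ (M ℕ.* c)) l) (addOK (scale (+ (s ℕ.∸ M ℕ.* c)) l) (scale (+ t) μ))
    α≡Mc·l+ρ = begin
      α                                                                              ≡⟨ α≡ ⟩
      addOK (scale (+ s) l) (scale (+ t) μ)                                           ≡⟨ cong (λ n → addOK (scale (+ n) l) (scale (+ t) μ)) (sym (ℕP.m+[n∸m]≡n Mc≤s)) ⟩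
      addOK (scale (+ (M ℕ.* c) + + (s ℕ.∸ M ℕ.* c)) l) (scale (+ t) μ)               ≡⟨ cong (λ u → addOK u (scale (+ t) μ)) (scale-+ (+ (M ℕ.* c)) (+ (s ℕ.∸ M ℕ.* c)) l) ⟩
      addOK (addOK (scale (+ (M ℕ.* c)) l) (scale (+ (s ℕ.∸ M ℕ.* c)) l)) (scale (+ t) μ) ≡⟨ addOK-assoc (scale (+ (M ℕ.* c)) l) (scale (+ (s ℕ.∸ M ℕ.* c)) l) (scale (+ t) μ) ⟩
      addOK (scale (+ (M ℕ.* c)) l) (addOK (scale (+ (s ℕ.∸ M ℕ.* c)) l) (scale (+ t) μ)) ∎
      where open ≡-Reasoning

  <·√-intro : ∀ {x y g Δ} → 0ℤ ≤ y → 0ℤ ≤ g → g * g ≤ Δ → x < y * g → x < y ·√ Δ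
  <·√-intro {x} {y} {g} {Δ} 0≤y 0≤g g²≤Δ x<yg with x ℤP.<? 0ℤ
  ... | yes x<0 = inj₁ x<0
  ... | no x≮0 = inj₂ (begin-strict
    x * x              <⟨ i*i<j*j (ℤP.≮⇒≥ x≮0) x<yg ⟩
    y * g * (y * g)    ≡⟨ expand y g ⟩
    y * y * (g * g)    ≤⟨ ℤP.*-monoˡ-≤-nonNeg (y * y) {{ℤ.nonNegative (0≤i*i y)}} g²≤Δ ⟩
    y * y * Δ          ∎)
    where
    open ℤP.≤-Reasoning
    expand : ∀ y g → y * g * (y * g) ≡ y * y * (g * g)
    expand = solve-∀

  C : ℕ → ℕ
  C m = m ℕ.* m ℕ.* (2 ℕ.* m ℕ.+ 1) ℕ.* (2 ℕ.* m ℕ.+ 3)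

  rearrange-bound : ∀ m Δ g {x} → x < + 4 * (+ m * + m * (+ 2 * + m + + 1) * (+ 2 * + m + + 3)) * + Δ
                                        + + m * + m * (+ 2 * + m + + 1) * (+ 2 * + m + + 3) * (+ Δ + + 4) * + g →
    x - + (4 ℕ.* C m ℕ.* Δ) < + (C m ℕ.* (Δ ℕ.+ 4)) * + g
  rearrange-bound m Δ g {x} x<4CΔ+C[Δ+4]g = begin-strict
    x - + (4 ℕ.* C m ℕ.* Δ)                                  ≡⟨ cong (_-_ x) 4CΔ≡ ⟩
    x - + 4 * Cℤ * + Δ                                       <⟨ ℤP.+-monoˡ-< (- (+ 4 * Cℤ * + Δ)) x<4CΔ+C[Δ+4]g ⟩
    + 4 * Cℤ * + Δ + Cℤ * (+ Δ + + 4) * + g - + 4 * Cℤ * + Δ ≡⟨ cancel (+ 4 * Cℤ * + Δ) (Cℤ * (+ Δ + + 4) * + g) ⟩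
    Cℤ * (+ Δ + + 4) * + g                                   ≡⟨ cong (_* + g) (sym C[Δ+4]≡) ⟩
    + (C m ℕ.* (Δ ℕ.+ 4)) * + g                              ∎
    where
    open ℤP.≤-Reasoning
    Cℤ = + m * + m * (+ 2 * + m + + 1) * (+ 2 * + m + + 3)
    2m+k≡ : ∀ k → + (2 ℕ.* m ℕ.+ k) ≡ + 2 * + m + + k
    2m+k≡ k = trans (ℤP.pos-+ (2 ℕ.* m) k) (cong (_+ + k) (ℤP.pos-* 2 m))
    C≡Cℤ : + C m ≡ Cℤ
    C≡Cℤ = trans (ℤP.pos-* (m ℕ.* m ℕ.* (2 ℕ.* m ℕ.+ 1)) (2 ℕ.* m ℕ.+ 3))
      (cong₂ _*_ (trans (ℤP.pos-* (m ℕ.* m) (2 ℕ.* m ℕ.+ 1)) (cong₂ _*_ (ℤP.pos-* m m) (2m+k≡ 1))) (2m+k≡ 3))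
    4CΔ≡ : + (4 ℕ.* C m ℕ.* Δ) ≡ + 4 * Cℤ * + Δ
    4CΔ≡ = trans (ℤP.pos-* (4 ℕ.* C m) Δ) (cong (_* + Δ) (trans (ℤP.pos-* 4 (C m)) (cong (+ 4 *_) C≡Cℤ)))
    C[Δ+4]≡ : + (C m ℕ.* (Δ ℕ.+ 4)) ≡ Cℤ * (+ Δ + + 4)
    C[Δ+4]≡ = trans (ℤP.pos-* (C m) (Δ ℕ.+ 4)) (cong₂ _*_ C≡Cℤ (ℤP.pos-+ Δ 4))
    cancel : ∀ x y → x + y - x ≡ y
    cancel = solve-∀

  -- c = ⌊(T + g) / 2a⌋ + 1 is the least integer with 2ac - T > √Δ, i.e. with c l - μ totally positive.
  norm-bound : ∀ m → 1 ℕ.≤ m → ∀ {α} → TotPos D α → AtMostRepsCount D α m →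
    (norm D α - + (4 ℕ.* C m ℕ.* disc D)) < (+ (C m ℕ.* (disc D ℕ.+ 4))) ·√ (+ (disc D))
  norm-bound m 1≤m {α} tα atMost =
    <·√-intro {y = + (C m ℕ.* (Δ ℕ.+ 4))} {Δ = + Δ} (0≤n _) (0≤n g) g²≤Δ (rearrange-bound m Δ g (ℤP.≤-<-trans (ℤP.≤-reflexive norm-α≡) form-bound′))
    where
    open BasisFacts (reduced-basis tα)
    Δ = disc D
    g = proj₁ (floor-sqrt Δ)
    g²≤Δ = proj₁ (proj₂ (floor-sqrt Δ))
    Δ<[g+1]² = proj₂ (proj₂ (floor-sqrt Δ))
    open Bounds {a} {b} {T} {+ Δ} {+ g} 0<a 0<b 0<T-a-b T²≡Δ+4ab (0≤n g) g²≤Δ Δ<[g+1]² (+≤+ 5≤disc)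
    0≤T+g : 0ℤ ≤ T + + g
    0≤T+g = 0≤+ (ℤP.<⇒≤ 0<T) (0≤n g)
    quotient-c = floor-quotient (0<* (0<1+n 1) 0<a) 0≤T+g
    quotient-d = floor-quotient (0<* (0<1+n 1) 0<b) 0≤T+g
    c d : ℕ
    c = suc (proj₁ quotient-c)
    d = suc (proj₁ quotient-d)
    T²≡Δ+4ba : T * T ≡ + Δ + + 4 * b * a
    T²≡Δ+4ba = trans T²≡Δ+4ab (cong (_+_ (+ Δ)) (trans (ℤP.*-assoc (+ 4) a b) (trans (cong (+ 4 *_) (ℤP.*-comm a b)) (sym (ℤP.*-assoc (+ 4) b a)))))
    s<mc : s ℕ.< m ℕ.* c
    s<mc = coefficient-bound m c s t indecomposable-l indecomposable-μ μ≢l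
      (totPos-c·l-μ Ql≡4a Qμ≡4b Blμ≡2T totPos-l T²≡Δ+4ab 0<a (0≤n g) Δ<[g+1]² (proj₂ (proj₂ quotient-c)))
      α≡s·l+t·μ tα atMost
    t<md : t ℕ.< m ℕ.* d
    t<md = coefficient-bound m d t s indecomposable-μ indecomposable-l (μ≢l ∘ sym)
      (totPos-c·l-μ Qμ≡4b Ql≡4a (trans (B-sym μ l) Blμ≡2T) totPos-μ T²≡Δ+4ba 0<b (0≤n g) Δ<[g+1]² (proj₂ (proj₂ quotient-d)))
      (trans α≡s·l+t·μ (addOK-comm (scale (+ s) l) (scale (+ t) μ))) tα atMost
    form-bound′ : form a T b (+ s) (+ t) < + 4 * (+ m * + m * (+ 2 * + m + + 1) * (+ 2 * + m + + 3)) * + Δ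
                                           + + m * + m * (+ 2 * + m + + 1) * (+ 2 * + m + + 3) * (+ Δ + + 4) * + g
    form-bound′ = form-bound {c = + c} {d = + d} (0<1+n _) (0<1+n _) (proj₁ (proj₂ quotient-c)) (proj₁ (proj₂ quotient-d))
      (0≤n s) (0≤n t) (subst (+ s <_) (ℤP.pos-* m c) (+<+ s<mc)) (subst (+ t <_) (ℤP.pos-* m d) (+<+ t<md)) (+≤+ 1≤m)
    norm-α≡ : norm D α ≡ form a T b (+ s) (+ t)
    norm-α≡ = trans (cong (norm D) α≡s·l+t·μ) (norm-combination (+ s) (+ t))

open import Defs
open import Data.Nat using (ℕ; _≤_; _+_; _*_)
open import Data.Integer using (+_; _-_)

theorem1p1 : (D : ℕ) → 2 ≤ D → SquareFree D → (m : ℕ) → 1 ≤ m →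
    (α : OK) → TotPos D α → AtMostRepsCount D α m →
    (norm D α - + (4 * (m * m * (2 * m + 1) * (2 * m + 3)) * disc D))
    < (+ (m * m * (2 * m + 1) * (2 * m + 3) * (disc D + 4))) ·√ (+ (disc D))
theorem1p1 D 2≤D sf m 1≤m α tα atMost = NormBound.norm-bound D 2≤D sf m 1≤m tα atMost
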